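{- For $s,t\in\mu_r$, $v,v'\in\mathcal{A}_1$ and $w\in\mathcal{A}_r$: (i) $vv'\diamond_s1=(v\diamond_s1)(v'\diamond_s1)$; (ii) $vy\diamond_s w(z-z_t^{\delta})=(vy\diamond_s w-v\diamond_s wz_t^{\delta})(y\diamond_t1)$; (iii) $yv\diamond_s zw=(y\diamond_s1)(v\diamond_s zw)+z(yv\diamond_s w)-z(y\diamond_s1)(v\diamond_s w)$; (iv) $yv\diamond_s z_t^{\delta}w=(y\diamond_s1)(v\diamond_s z_t^{\delta}w)+z_t^{\delta}(yv\diamond_t w)$; (v) $zv\diamond_s zw=z\bigl(v\diamond_s zw+zv\diamond_s w-z(v\diamond_s w)\bigr)$; (vi) $zv\diamond_s z_t^{\delta}w=z(v\diamond_s z_t^{\delta}w)+z_t^{\delta}(zv\diamond_t w)-zz_t^{\delta}(v\diamond_t w)$; (vii) $\tau(v\diamond_s1)=\tau(v)\diamond_s1$.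
   Context: Let $r\ge1$, $\mu_r$ the $r$-th roots of unity, $\mathcal{A}_r=\mathbb{Q}\langle x,y_s\mid s\in\mu_r\rangle$, $y=y_1$, $z=x+y_1$, $z_t=x+y_t$, $z_s^{\delta}=x+\delta(s)y_s$ with $\delta(1)=0$, $\delta(s)=1$ for $s\ne1$, $z_{k,s}=x^{k-1}y_s$, $\mathcal{A}_1=\mathbb{Q}\langle x,y\rangle\subset\mathcal{A}_r$. $\tau$ is the anti-automorphism of $\mathcal{A}_r$ with $\tau(x)=y_1$, $\tau(y_1)=x$, $\tau(y_s)=-y_s$ for $s\ne1$. $\varphi$: automorphism of $\mathcal{A}_r$ with $\varphi(x)=z$, $\varphi(y_s)=\delta(s)y_s-y_1$. $\mathcal{I}(z_{k_1,s_1}\cdots z_{k_l,s_l}x^a)=z_{k_1,s_1}z_{k_2,s_1s_2}\cdots z_{k_l,s_1\cdots s_l}x^a$, $M_s(z_{k_1,s_1}\cdots z_{k_l,s_l}x^a)=z_{k_1,ss_1}z_{k_2,s_2}\cdots z_{k_l,s_l}x^a$ (linear, $a\ge0$), $\psi_s=\varphi\mathcal{I}M_s$. Diamond product $\diamond_s:\mathcal{A}_1\times\mathcal{A}_r\to\mathcal{A}_r$ ($s\in\mu_r$): $\mathbb{Q}$-bilinear, defined recursively for words $v\in\mathcal{A}_1,w\in\mathcal{A}_r$, $1\ne t\in\mu_r$ by $1\diamond_s w=w$, $v\diamond_s1=\psi_s\varphi(v)$, $vx\diamond_s wx=(v\diamond_s wx)x-(vy\diamond_s w)x$, $vy\diamond_s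 wx=(v\diamond_s wx)y+(vy\diamond_s w)x$, $vx\diamond_s wy=(v\diamond_s wy)x+(vx\diamond_s w)y$, $vy\diamond_s wy=(v\diamond_s wy)y-(vx\diamond_s w)y$, $vx\diamond_s wy_t=(v\diamond_s wy_t)x+(v\diamond_s wz_t)y_t-(vy\diamond_s w)y_t$, $vy\diamond_s wy_t=(v\diamond_s wy_t)y-(v\diamond_s wz_t)y_t+(vy\diamond_s w)y_t$. -}

module Defs where

open import Data.Nat using (ℕ; zero; suc; _+_)
open import Data.Nat.DivMod using (_mod_)
open import Data.Fin using (Fin; zero; suc; toℕ)
import Data.Fin.Properties as FinP
open import Data.Rational using (ℚ; 0ℚ; 1ℚ) renaming (_+_ to _+ℚ_; _*_ to _*ℚ_; -_ to -ℚ_)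
open import Data.List using (List; []; _∷_; _++_; map; concatMap; reverse; length)
open import Data.List.Properties using (≡-dec)
open import Data.Product using (_×_; _,_)
open import Relation.Binary.PropositionalEquality using (_≡_; refl)
open import Relation.Binary.Definitions using (DecidableEquality)
open import Relation.Nullary using (yes; no; does)
open import Data.Bool using (if_then_else_)

-- Free noncommutative Q-algebra on an alphabet A:
-- an element is a formal finite Q-linear combination of words,
-- equality in the algebra is "same coefficient on every word" (_≈_ below).

Poly : Set → Set
Poly A = List (ℚ × List A)

module _ {A : Set} where
  𝟘 : Poly A
  𝟘 = []

  𝟙 : Poly A
  𝟙 = (1ℚ , []) ∷ []

  word : List A → Poly A
  word u = (1ℚ , u) ∷ []

  letter : A → Poly A
  letter a = word (a ∷ [])

  infixl 6 _⊕_ _⊖_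
  infixl 7 _⊗_

  _⊕_ : Poly A → Poly A → Poly A
  P ⊕ Q = P ++ Q

  sc : ℚ → Poly A → Poly A
  sc c P = map (λ { (d , u) → (c *ℚ d , u) }) P

  _⊖_ : Poly A → Poly A → Poly A
  P ⊖ Q = P ⊕ sc (-ℚ 1ℚ) Q

  _⊗_ : Poly A → Poly A → Poly A
  P ⊗ Q = concatMap (λ { (c , u) → map (λ { (d , v) → (c *ℚ d , u ++ v) }) Q }) P

  coeff : DecidableEquality A → Poly A → List A → ℚ
  coeff _≟_ [] w = 0ℚ
  coeff _≟_ ((c , u) ∷ P) w =
    if does (≡-dec _≟_ u w) then c +ℚ coeff _≟_ P w else coeff _≟_ P w

module _ {A B : Set} where
  lin : (List A → Poly B) → Poly A → Poly B
  lin f P = concatMap (λ { (c , u) → sc c (f u) }) P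

  mult : (A → Poly B) → List A → Poly B
  mult f [] = 𝟙
  mult f (a ∷ u) = f a ⊗ mult f u

  antimult : (A → Poly B) → List A → Poly B
  antimult f u = mult f (reverse u)

-- mu_r with r = suc m, identified with Z/r via exp(2 pi i k / r) <-> k.
-- The root 1 is zero; multiplication of roots is addition mod r.

infixl 7 _·_
_·_ : {m : ℕ} → Fin (suc m) → Fin (suc m) → Fin (suc m)
_·_ {m} s t = (toℕ s + toℕ t) mod (suc m)

δ : {m : ℕ} → Fin (suc m) → ℚ
δ zero = 0ℚ
δ (suc _) = 1ℚ

data Let (m : ℕ) : Set where
  xL : Let m
  yL : Fin (suc m) → Let m

data L1 : Set where
  x1 y1 : L1

_≟L_ : {m : ℕ} → DecidableEquality (Let m)
xL ≟L xL = yes refl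
xL ≟L yL _ = no (λ ())
yL _ ≟L xL = no (λ ())
yL s ≟L yL t with s FinP.≟ t
... | yes refl = yes refl
... | no ne = no (λ { refl → ne refl })

Ar : ℕ → Set
Ar m = Poly (Let m)

A1 : Set
A1 = Poly L1

infix 4 _≈_
_≈_ : {m : ℕ} → Ar m → Ar m → Set
P ≈ Q = ∀ w → coeff _≟L_ P w ≡ coeff _≟L_ Q w

x₁ y₁ z₁ : A1
x₁ = letter x1
y₁ = letter y1
z₁ = x₁ ⊕ y₁

X : {m : ℕ} → Ar m
X = letter xL

Y : {m : ℕ} → Fin (suc m) → Ar m
Y s = letter (yL s)

Z : {m : ℕ} → Ar m
Z = X ⊕ Y zero

Zt : {m : ℕ} → Fin (suc m) → Ar m
Zt t = X ⊕ Y t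

Zδ : {m : ℕ} → Fin (suc m) → Ar m
Zδ t = X ⊕ sc (δ t) (Y t)

ιL : {m : ℕ} → L1 → Let m
ιL x1 = xL
ιL y1 = yL zero

ιw : {m : ℕ} → List L1 → List (Let m)
ιw = map ιL

ι : {m : ℕ} → A1 → Ar m
ι = lin (λ u → word (ιw u))

φL : {m : ℕ} → Let m → Ar m
φL xL = Z
φL (yL s) = sc (δ s) (Y s) ⊖ Y zero

φ : {m : ℕ} → Ar m → Ar m
φ = lin (mult φL)

τL : {m : ℕ} → Let m → Ar m
τL xL = Y zero
τL (yL zero) = X
τL (yL (suc k)) = sc (-ℚ 1ℚ) (Y (suc k))

τ : {m : ℕ} → Ar m → Ar m
τ = lin (antimult τL)

τ1L : L1 → A1
τ1L x1 = y₁
τ1L y1 = x₁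

τ₁ : A1 → A1
τ₁ = lin (antimult τ1L)

-- A word z_{k1,s1}…z_{kl,sl} x^a is exactly a word in
-- x, y_s; I replaces the index of the j-th y-letter by s1⋯sj (running
-- product), M_s multiplies the index of the first y-letter by s.
Iw : {m : ℕ} → Fin (suc m) → List (Let m) → List (Let m)
Iw acc [] = []
Iw acc (xL ∷ u) = xL ∷ Iw acc u
Iw acc (yL s ∷ u) = yL (acc · s) ∷ Iw (acc · s) u

Mw : {m : ℕ} → Fin (suc m) → List (Let m) → List (Let m)
Mw s [] = []
Mw s (xL ∷ u) = xL ∷ Mw s u
Mw s (yL t ∷ u) = yL (s · t) ∷ u

I : {m : ℕ} → Ar m → Ar m
I = lin (λ u → word (Iw zero u))

M : {m : ℕ} → Fin (suc m) → Ar m → Ar m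
M s = lin (λ u → word (Mw s u))

ψ : {m : ℕ} → Fin (suc m) → Ar m → Ar m
ψ s P = φ (I (M s P))

-- Words are passed REVERSED (head = last
-- letter) so the recursion on last letters is by pattern matching.
-- The ℕ argument is fuel; diaW supplies |v|+|w|, which always suffices
-- since each recursive call lowers |v|+|w| by at least one.

dia : {m : ℕ} → ℕ → Fin (suc m) → List L1 → List (Let m) → Ar m
dia s' s [] w = word (reverse w)
dia _ s (a ∷ v) [] = ψ s (φ (ι (word (reverse (a ∷ v)))))
dia zero s (_ ∷ _) (_ ∷ _) = 𝟘
dia (suc n) s (x1 ∷ v) (xL ∷ w) =
  dia n s v (xL ∷ w) ⊗ X ⊖ dia n s (y1 ∷ v) w ⊗ X
dia (suc n) s (y1 ∷ v) (xL ∷ w) =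
  dia n s v (xL ∷ w) ⊗ Y zero ⊕ dia n s (y1 ∷ v) w ⊗ X
dia (suc n) s (x1 ∷ v) (yL zero ∷ w) =
  dia n s v (yL zero ∷ w) ⊗ X ⊕ dia n s (x1 ∷ v) w ⊗ Y zero
dia (suc n) s (y1 ∷ v) (yL zero ∷ w) =
  dia n s v (yL zero ∷ w) ⊗ Y zero ⊖ dia n s (x1 ∷ v) w ⊗ Y zero
dia (suc n) s (x1 ∷ v) (yL (suc k) ∷ w) =
  dia n s v (yL (suc k) ∷ w) ⊗ X
  ⊕ (dia n s v (xL ∷ w) ⊕ dia n s v (yL (suc k) ∷ w)) ⊗ Y (suc k)
  ⊖ dia n s (y1 ∷ v) w ⊗ Y (suc k)
dia (suc n) s (y1 ∷ v) (yL (suc k) ∷ w) =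
  dia n s v (yL (suc k) ∷ w) ⊗ Y zero
  ⊖ (dia n s v (xL ∷ w) ⊕ dia n s v (yL (suc k) ∷ w)) ⊗ Y (suc k)
  ⊕ dia n s (y1 ∷ v) w ⊗ Y (suc k)

diaW : {m : ℕ} → Fin (suc m) → List L1 → List (Let m) → Ar m
diaW s v w = dia (length v + length w) s (reverse v) (reverse w)

infix 5 _⋄[_]_
_⋄[_]_ : {m : ℕ} → A1 → Fin (suc m) → Ar m → Ar m
P ⋄[ s ] Q =
  concatMap (λ { (c , v) → concatMap (λ { (d , w) → sc (c *ℚ d) (diaW s v w) }) Q }) P

module Submission where

-- Write D s V W for v ⋄_s w, where V and W are the reversals of the words v
-- and w; the defining recursion of ⋄ then recurses on the heads of V and W,
-- and each right-hand side is a combination of values of ⋄ multiplied on the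
-- right.  Hence any combination Σ L ⊗ (p v ⋄_σ q w) of diamonds of shifted
-- words with left coefficients L satisfies the same recursion, and so vanishes
-- as soon as it vanishes when v or w is empty, where ⋄ is explicit:
-- v ⋄_s 1 = ψ_s φ(v) is multiplicative on words and 1 ⋄_s w = w.  Identities
-- (iii)-(vi) are vanishing statements of this kind, (ii) follows from one step
-- of the recursion, and (i) and (vii) from the multiplicativity of v ⋄_s 1.
-- Everything is lifted from words to polynomials by bilinearity.

open import Defs
open import Data.Bool using (Bool; true; false; if_then_else_)
open import Data.Nat using (ℕ; zero; suc; _<ᵇ_; _≡ᵇ_) renaming (_+_ to _+ℕ_)
open import Data.Nat.DivMod using (_mod_; m<n⇒m%n≡m)
open import Data.Nat.Properties using (+-identityʳ; +-suc; suc-injective)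
open import Data.Fin using (Fin; zero; suc; toℕ)
import Data.Fin.Properties as Fin
open import Data.Product using (_×_; _,_; proj₂)
open import Data.Rational using (ℚ; 0ℚ; 1ℚ; _+_; _*_; -_)
import Data.Rational.Properties as ℚ
open import Data.Rational.Solver using (module +-*-Solver)
open import Data.List using (List; []; _∷_; _++_; map; length; reverse)
import Data.List.Properties as List
open import Data.List.Relation.Unary.All as All using (All; []; _∷_)
import Data.List.Relation.Unary.All.Properties as All
open import Data.Vec using (Vec; lookup; tabulate; []; _∷_)
open import Data.Vec.N-ary using (N-ary; _$ⁿ_)
open import Relation.Binary.Bundles using (Setoid)
open import Relation.Binary.PropositionalEquality
import Relation.Binary.Reasoning.Setoid as SetoidReasoning
open import Relation.Nullary using (Dec; yes; no; does)

open +-*-Solver using (_:+_; _:*_; _:=_) renaming (solve to solveℚ)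

-- Formal sums and linear functionals

*-+-factorˡ : ∀ c d a e → c * d * a + c * e ≡ c * (d * a + e)
*-+-factorˡ = solveℚ 4 (λ c d a e → c :* d :* a :+ c :* e := c :* (d :* a :+ e)) refl

module _ {A : Set} where

  eval : (List A → ℚ) → Poly A → ℚ
  eval h [] = 0ℚ
  eval h ((c , u) ∷ P) = c * h u + eval h P

  -- Elements of the free algebra are equal when all linear functionals,
  -- i.e. all assignments of scalars to words, agree on them.
  infix 4 _≋_
  record _≋_ (P Q : Poly A) : Set where
    constructor mk≋
    field eval-≡ : ∀ h → eval h P ≡ eval h Q
  open _≋_ public

  ≋-refl : ∀ {P} → P ≋ P
  ≋-refl = mk≋ λ _ → refl

  ≋-sym : ∀ {P Q} → P ≋ Q → Q ≋ P
  ≋-sym p = mk≋ λ h → sym (eval-≡ p h)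

  ≋-trans : ∀ {P Q R} → P ≋ Q → Q ≋ R → P ≋ R
  ≋-trans p q = mk≋ λ h → trans (eval-≡ p h) (eval-≡ q h)

  ≋-reflexive : ∀ {P Q} → P ≡ Q → P ≋ Q
  ≋-reflexive refl = ≋-refl

  ≋-setoid : Setoid _ _
  ≋-setoid = record
    { Carrier = Poly A ; _≈_ = _≋_
    ; isEquivalence = record { refl = ≋-refl ; sym = ≋-sym ; trans = ≋-trans } }

  eval-cong : ∀ {h h′ : List A → ℚ} → (∀ u → h u ≡ h′ u) → ∀ P → eval h P ≡ eval h′ P
  eval-cong e [] = refl
  eval-cong e ((c , u) ∷ P) = cong₂ (λ a b → c * a + b) (e u) (eval-cong e P)

  eval-++ : ∀ h P Q → eval h (P ++ Q) ≡ eval h P + eval h Q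
  eval-++ h [] Q = sym (ℚ.+-identityˡ _)
  eval-++ h ((c , u) ∷ P) Q =
    trans (cong (c * h u +_) (eval-++ h P Q)) (sym (ℚ.+-assoc (c * h u) _ _))

  eval-sc : ∀ h c P → eval h (sc c P) ≡ c * eval h P
  eval-sc h c [] = sym (ℚ.*-zeroʳ c)
  eval-sc h c ((d , u) ∷ P) = trans (cong (c * d * h u +_) (eval-sc h c P)) (*-+-factorˡ c d (h u) _)

  eval-word : ∀ h u → eval h (word u) ≡ h u
  eval-word h u = trans (ℚ.+-identityʳ _) (ℚ.*-identityˡ _)

  eval-sum : ∀ h h′ P → eval (λ u → h u + h′ u) P ≡ eval h P + eval h′ P
  eval-sum h h′ [] = sym (ℚ.+-identityˡ _)
  eval-sum h h′ ((c , u) ∷ P) = trans (cong (c * (h u + h′ u) +_) (eval-sum h h′ P)) (law c _ _ _ _)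
    where
    law : ∀ c a b e f → c * (a + b) + (e + f) ≡ (c * a + e) + (c * b + f)
    law = solveℚ 5 (λ c a b e f → c :* (a :+ b) :+ (e :+ f) := (c :* a :+ e) :+ (c :* b :+ f)) refl

  eval-scale : ∀ c h P → eval (λ u → c * h u) P ≡ c * eval h P
  eval-scale c h [] = sym (ℚ.*-zeroʳ c)
  eval-scale c h ((d , u) ∷ P) = trans (cong (d * (c * h u) +_) (eval-scale c h P)) (law d c (h u) _)
    where
    law : ∀ d c a e → d * (c * a) + c * e ≡ c * (d * a + e)
    law = solveℚ 4 (λ d c a e → d :* (c :* a) :+ c :* e := c :* (d :* a :+ e)) refl

  eval-zero : ∀ P → eval (λ _ → 0ℚ) P ≡ 0ℚ
  eval-zero [] = refl
  eval-zero ((c , u) ∷ P) = trans (cong (c * 0ℚ +_) (eval-zero P)) (trans (ℚ.+-identityʳ _) (ℚ.*-zeroʳ c))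

  eval-⊗ : ∀ h P Q → eval h (P ⊗ Q) ≡ eval (λ u → eval (λ v → h (u ++ v)) Q) P
  eval-⊗ h [] Q = refl
  eval-⊗ h ((c , u) ∷ P) Q =
    trans (cong (eval h) split)
      (trans (eval-++ h (((c , u) ∷ []) ⊗ Q) (P ⊗ Q)) (cong₂ _+_ (monomial Q) (eval-⊗ h P Q)))
    where
    split : ((c , u) ∷ P) ⊗ Q ≡ ((c , u) ∷ []) ⊗ Q ++ P ⊗ Q
    split = cong (_++ P ⊗ Q) (sym (List.++-identityʳ _))
    monomial : ∀ Q → eval h (((c , u) ∷ []) ⊗ Q) ≡ c * eval (λ v → h (u ++ v)) Q
    monomial [] = sym (ℚ.*-zeroʳ c)
    monomial ((d , v) ∷ Q) = trans (cong (c * d * h (u ++ v) +_) (monomial Q)) (*-+-factorˡ c d _ _)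

  ⊕-cong : ∀ {P P′ Q Q′ : Poly A} → P ≋ P′ → Q ≋ Q′ → P ⊕ Q ≋ P′ ⊕ Q′
  ⊕-cong {P} {P′} {Q} {Q′} p q = mk≋ λ h →
    trans (eval-++ h P Q) (trans (cong₂ _+_ (eval-≡ p h) (eval-≡ q h)) (sym (eval-++ h P′ Q′)))

  sc-cong : ∀ c {P Q : Poly A} → P ≋ Q → sc c P ≋ sc c Q
  sc-cong c {P} {Q} p = mk≋ λ h →
    trans (eval-sc h c P) (trans (cong (c *_) (eval-≡ p h)) (sym (eval-sc h c Q)))

  ⊖-cong : ∀ {P P′ Q Q′ : Poly A} → P ≋ P′ → Q ≋ Q′ → P ⊖ Q ≋ P′ ⊖ Q′
  ⊖-cong p q = ⊕-cong p (sc-cong (- 1ℚ) q)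

  ⊗-cong : ∀ {P P′ Q Q′ : Poly A} → P ≋ P′ → Q ≋ Q′ → P ⊗ Q ≋ P′ ⊗ Q′
  ⊗-cong {P} {P′} {Q} {Q′} p q = mk≋ λ h →
    trans (eval-⊗ h P Q) (trans (eval-cong (λ u → eval-≡ q (λ v → h (u ++ v))) P)
      (trans (eval-≡ p _) (sym (eval-⊗ h P′ Q′))))

  ⊗-assoc : ∀ (P Q R : Poly A) → (P ⊗ Q) ⊗ R ≋ P ⊗ (Q ⊗ R)
  ⊗-assoc P Q R = mk≋ λ h →
    trans (eval-⊗ h (P ⊗ Q) R) (trans (eval-⊗ _ P Q)
      (trans (eval-cong (λ u → eval-cong (λ v → eval-cong (λ w → cong h (List.++-assoc u v w)) R) Q) P)
        (sym (trans (eval-⊗ h P (Q ⊗ R)) (eval-cong (λ u → eval-⊗ _ Q R) P)))))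

  ⊗-identityˡ : ∀ (P : Poly A) → 𝟙 ⊗ P ≋ P
  ⊗-identityˡ P = mk≋ λ h → trans (eval-⊗ h 𝟙 P) (eval-word (λ u → eval (λ v → h (u ++ v)) P) [])

  ⊗-identityʳ : ∀ (P : Poly A) → P ⊗ 𝟙 ≋ P
  ⊗-identityʳ P = mk≋ λ h → trans (eval-⊗ h P 𝟙)
    (eval-cong (λ u → trans (eval-word (λ v → h (u ++ v)) []) (cong h (List.++-identityʳ u))) P)

  word-++ : ∀ (u v : List A) → word (u ++ v) ≋ word u ⊗ word v
  word-++ u v = mk≋ λ h → trans (eval-word h (u ++ v)) (sym (trans (eval-⊗ h (word u) (word v))
    (trans (eval-word (λ u′ → eval (λ v′ → h (u′ ++ v′)) (word v)) u) (eval-word (λ v′ → h (u ++ v′)) v))))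

module _ {A B : Set} where

  eval-swap : ∀ (H : List A → List B → ℚ) P (Q : Poly B) →
    eval (λ u → eval (H u) Q) P ≡ eval (λ v → eval (λ u → H u v) P) Q
  eval-swap H [] Q = sym (eval-zero Q)
  eval-swap H ((c , u) ∷ P) Q =
    trans (cong₂ _+_ (sym (eval-scale c (H u) Q)) (eval-swap H P Q))
      (sym (eval-sum (λ v → c * H u v) (λ v → eval (λ u → H u v) P) Q))

  eval-lin : ∀ h (F : List A → Poly B) P → eval h (lin F P) ≡ eval (λ u → eval h (F u)) P
  eval-lin h F [] = refl
  eval-lin h F ((c , u) ∷ P) =
    trans (eval-++ h (sc c (F u)) (lin F P)) (cong₂ _+_ (eval-sc h c (F u)) (eval-lin h F P))

module _ {A B : Set} where

  lin-cong : ∀ (F : List A → Poly B) {P Q} → P ≋ Q → lin F P ≋ lin F Q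
  lin-cong F {P} {Q} p = mk≋ λ h →
    trans (eval-lin h F P) (trans (eval-≡ p _) (sym (eval-lin h F Q)))

  lin-ext : ∀ {F G : List A → Poly B} → (∀ u → F u ≋ G u) → ∀ P → lin F P ≋ lin G P
  lin-ext {F} {G} e P = mk≋ λ h →
    trans (eval-lin h F P) (trans (eval-cong (λ u → eval-≡ (e u) h) P) (sym (eval-lin h G P)))

  lin-⊕ : ∀ (F : List A → Poly B) P Q → lin F (P ⊕ Q) ≋ lin F P ⊕ lin F Q
  lin-⊕ F P Q = mk≋ λ h → trans (eval-lin h F (P ⊕ Q)) (trans (eval-++ _ P Q)
     (sym (trans (eval-++ h (lin F P) (lin F Q)) (cong₂ _+_ (eval-lin h F P) (eval-lin h F Q)))))

  lin-sc : ∀ (F : List A → Poly B) c P → lin F (sc c P) ≋ sc c (lin F P)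
  lin-sc F c P = mk≋ λ h → trans (eval-lin h F (sc c P)) (trans (eval-sc _ c P)
     (sym (trans (eval-sc h c (lin F P)) (cong (c *_) (eval-lin h F P)))))

  lin-ext-on : ∀ {F G : List A → Poly B} P → All (λ t → F (proj₂ t) ≋ G (proj₂ t)) P → lin F P ≋ lin G P
  lin-ext-on [] [] = ≋-refl
  lin-ext-on ((c , u) ∷ P) (e ∷ es) = ⊕-cong (sc-cong c e) (lin-ext-on P es)

  lin-word : ∀ (F : List A → Poly B) u → lin F (word u) ≋ F u
  lin-word F u = mk≋ λ h → trans (eval-lin h F (word u)) (eval-word (λ u → eval h (F u)) u)

  lin-⊗ : ∀ (F : List A → Poly B) → (∀ u v → F (u ++ v) ≋ F u ⊗ F v) →
          ∀ P Q → lin F (P ⊗ Q) ≋ lin F P ⊗ lin F Q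
  lin-⊗ F F-++ P Q = mk≋ λ h →
    trans (eval-lin h F (P ⊗ Q)) (trans (eval-⊗ _ P Q)
      (trans (eval-cong (λ u → trans (eval-cong (λ v → trans (eval-≡ (F-++ u v) h) (eval-⊗ h (F u) (F v))) Q)
                         (eval-swap (λ v w → eval (λ w′ → h (w ++ w′)) (F v)) Q (F u))) P)
        (sym (trans (eval-⊗ h (lin F P) (lin F Q))
          (trans (eval-lin _ F P) (eval-cong (λ u → eval-cong (λ w → eval-lin _ F Q) (F u)) P))))))

  lin-⊗-reverse : ∀ (F : List A → Poly B) → (∀ u v → F (u ++ v) ≋ F v ⊗ F u) →
                  ∀ P Q → lin F (P ⊗ Q) ≋ lin F Q ⊗ lin F P
  lin-⊗-reverse F F-++ P Q = mk≋ λ h →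
    trans (eval-lin h F (P ⊗ Q)) (trans (eval-⊗ _ P Q)
     (trans (eval-cong (λ u → eval-cong (λ v → trans (eval-≡ (F-++ u v) h) (eval-⊗ h (F v) (F u))) Q) P)
      (sym (trans (eval-⊗ h (lin F Q) (lin F P))
        (trans (eval-lin _ F Q)
         (trans (eval-cong (λ v → eval-cong (λ a → eval-lin _ F P) (F v)) Q)
          (trans (eval-cong (λ v → eval-swap (λ a u → eval (λ b → h (a ++ b)) (F u)) (F v) P) Q)
            (eval-swap (λ v u → eval (λ a → eval (λ b → h (a ++ b)) (F u)) (F v)) Q P))))))))

  mult-++ : ∀ (g : A → Poly B) u v → mult g (u ++ v) ≋ mult g u ⊗ mult g v
  mult-++ g [] v = ≋-sym (⊗-identityˡ _)
  mult-++ g (a ∷ u) v = ≋-trans (⊗-cong (≋-refl {P = g a}) (mult-++ g u v)) (≋-sym (⊗-assoc (g a) _ _))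

  mult-cong : ∀ {g g′ : A → Poly B} → (∀ a → g a ≋ g′ a) → ∀ u → mult g u ≋ mult g′ u
  mult-cong e [] = ≋-refl
  mult-cong e (a ∷ u) = ⊗-cong (e a) (mult-cong e u)

module _ {A B C : Set} where

  lin-lin : ∀ (F : List B → Poly C) (G : List A → Poly B) P → lin F (lin G P) ≋ lin (λ u → lin F (G u)) P
  lin-lin F G P = mk≋ λ h → trans (eval-lin h F (lin G P)) (trans (eval-lin _ G P)
     (sym (trans (eval-lin h _ P) (eval-cong (λ u → eval-lin h F (G u)) P))))

  mult-map : ∀ (g : B → Poly C) (f : A → B) u → mult g (map f u) ≡ mult (λ a → g (f a)) u
  mult-map g f [] = refl
  mult-map g f (a ∷ u) = cong (g (f a) ⊗_) (mult-map g f u)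

  lin-mult : ∀ (F : List B → Poly C) → F [] ≋ 𝟙 → (∀ u v → F (u ++ v) ≋ F u ⊗ F v) →
             ∀ (g : A → Poly B) u → lin F (mult g u) ≋ mult (λ a → lin F (g a)) u
  lin-mult F F-[] F-++ g [] = ≋-trans (lin-word F []) F-[]
  lin-mult F F-[] F-++ g (a ∷ u) =
    ≋-trans (lin-⊗ F F-++ (g a) (mult g u)) (⊗-cong (≋-refl {P = lin F (g a)}) (lin-mult F F-[] F-++ g u))

eval-⊗ˡ : ∀ {A : Set} h (C P : Poly A) → eval h (C ⊗ P) ≡ eval (λ p → eval (λ c → h (c ++ p)) C) P
eval-⊗ˡ h C P = trans (eval-⊗ h C P) (eval-swap (λ c p → h (c ++ p)) C P)

-- A normaliser for the free associative algebra; atoms do not commute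

infixl 6 _⊞_ _⊟_
infixl 7 _⊠_
infixr 8 _⊡_

data Expr (n : ℕ) : Set where
  var : Fin n → Expr n
  𝟘ᵉ 𝟙ᵉ : Expr n
  _⊞_ _⊟_ _⊠_ : Expr n → Expr n → Expr n
  _⊡_ : ℚ → Expr n → Expr n

module _ {A : Set} {n : ℕ} where

  ⟦_⟧ : Expr n → Vec (Poly A) n → Poly A
  ⟦ var i ⟧ ρ = lookup ρ i
  ⟦ 𝟘ᵉ ⟧ ρ = 𝟘
  ⟦ 𝟙ᵉ ⟧ ρ = 𝟙
  ⟦ e ⊞ f ⟧ ρ = ⟦ e ⟧ ρ ⊕ ⟦ f ⟧ ρ
  ⟦ e ⊟ f ⟧ ρ = ⟦ e ⟧ ρ ⊖ ⟦ f ⟧ ρ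
  ⟦ e ⊠ f ⟧ ρ = ⟦ e ⟧ ρ ⊗ ⟦ f ⟧ ρ
  ⟦ c ⊡ e ⟧ ρ = sc c (⟦ e ⟧ ρ)

nf : ∀ {n} → Expr n → Poly (Fin n)
nf (var i) = letter i
nf 𝟘ᵉ = 𝟘
nf 𝟙ᵉ = 𝟙
nf (e ⊞ f) = nf e ⊕ nf f
nf (e ⊟ f) = nf e ⊖ nf f
nf (e ⊠ f) = nf e ⊗ nf f
nf (c ⊡ e) = sc c (nf e)

module _ {n : ℕ} where

  _<ʷ_ : List (Fin n) → List (Fin n) → Bool
  [] <ʷ [] = false
  [] <ʷ (_ ∷ _) = true
  (_ ∷ _) <ʷ [] = false
  (i ∷ u) <ʷ (j ∷ v) =
    if toℕ i <ᵇ toℕ j then true else if toℕ i ≡ᵇ toℕ j then u <ʷ v else false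

  insert : ℚ → List (Fin n) → Poly (Fin n) → Poly (Fin n)
  insert c u [] = (c , u) ∷ []
  insert c u ((d , v) ∷ Q) with List.≡-dec Fin._≟_ u v
  ... | yes _ = (c + d , v) ∷ Q
  ... | no _ = if u <ʷ v then (c , u) ∷ (d , v) ∷ Q else (d , v) ∷ insert c u Q

  sort : Poly (Fin n) → Poly (Fin n)
  sort [] = []
  sort ((c , u) ∷ P) = insert c u (sort P)

  dropZeros : Poly (Fin n) → Poly (Fin n)
  dropZeros [] = []
  dropZeros ((c , u) ∷ P) with c ℚ.≟ 0ℚ
  ... | yes _ = dropZeros P
  ... | no _ = (c , u) ∷ dropZeros P

  canonical : Poly (Fin n) → Poly (Fin n)
  canonical P = dropZeros (sort P)

  eval-insert : ∀ h c u Q → eval h (insert c u Q) ≡ c * h u + eval h Q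
  eval-insert h c u [] = refl
  eval-insert h c u ((d , v) ∷ Q) with List.≡-dec Fin._≟_ u v
  ... | yes refl = law c d (h u) (eval h Q)
    where
    law : ∀ c d a e → (c + d) * a + e ≡ c * a + (d * a + e)
    law = solveℚ 4 (λ c d a e → (c :+ d) :* a :+ e := c :* a :+ (d :* a :+ e)) refl
  ... | no _ with u <ʷ v
  ...   | true = refl
  ...   | false = trans (cong (d * h v +_) (eval-insert h c u Q)) (law (d * h v) (c * h u) (eval h Q))
    where
    law : ∀ a b e → a + (b + e) ≡ b + (a + e)
    law = solveℚ 3 (λ a b e → a :+ (b :+ e) := b :+ (a :+ e)) refl

  eval-sort : ∀ h P → eval h (sort P) ≡ eval h P
  eval-sort h [] = refl
  eval-sort h ((c , u) ∷ P) = trans (eval-insert h c u (sort P)) (cong (c * h u +_) (eval-sort h P))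

  eval-dropZeros : ∀ h P → eval h (dropZeros P) ≡ eval h P
  eval-dropZeros h [] = refl
  eval-dropZeros h ((c , u) ∷ P) with c ℚ.≟ 0ℚ
  ... | yes refl = trans (eval-dropZeros h P)
                     (sym (trans (cong (_+ eval h P) (ℚ.*-zeroˡ (h u))) (ℚ.+-identityˡ _)))
  ... | no _ = cong (c * h u +_) (eval-dropZeros h P)

  eval-canonical : ∀ h P → eval h (canonical P) ≡ eval h P
  eval-canonical h P = trans (eval-dropZeros h (sort P)) (eval-sort h P)

-- Hypotheses  a ≔ e  let the solver replace the atom a by e; the
-- right-hand side of a hypothesis may use atoms defined further down the list.
infix 5.5 _≔_
_≔_ : ∀ {n} → Expr n → Expr n → Expr n × Expr n
a ≔ e = a , e

infix 5.5 _∙_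
_∙_ : ∀ {n} → Expr n → Expr n → Expr n × Expr n
c ∙ e = c , e

Σᵉ : ∀ {n} → List (Expr n × Expr n) → Expr n
Σᵉ [] = 𝟘ᵉ
Σᵉ ((c , e) ∷ ts) = c ⊠ e ⊞ Σᵉ ts

infix 3 _⊢_≐_
record Equation (n : ℕ) : Set where
  constructor _⊢_≐_
  field
    hypotheses : List (Expr n × Expr n)
    lhs rhs : Expr n

module _ {n : ℕ} where

  isVar : (e : Expr n) (i : Fin n) → Dec (e ≡ var i)
  isVar (var j) i with j Fin.≟ i
  ... | yes refl = yes refl
  ... | no j≢i = no λ { refl → j≢i refl }
  isVar 𝟘ᵉ i = no λ ()
  isVar 𝟙ᵉ i = no λ ()
  isVar (_ ⊞ _) i = no λ ()
  isVar (_ ⊟ _) i = no λ ()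
  isVar (_ ⊠ _) i = no λ ()
  isVar (_ ⊡ _) i = no λ ()

  mutual
    unfold : List (Expr n × Expr n) → Expr n → Expr n
    unfold ds (var i) = unfoldVar ds i
    unfold ds 𝟘ᵉ = 𝟘ᵉ
    unfold ds 𝟙ᵉ = 𝟙ᵉ
    unfold ds (e ⊞ f) = unfold ds e ⊞ unfold ds f
    unfold ds (e ⊟ f) = unfold ds e ⊟ unfold ds f
    unfold ds (e ⊠ f) = unfold ds e ⊠ unfold ds f
    unfold ds (c ⊡ e) = c ⊡ unfold ds e

    unfoldVar : List (Expr n × Expr n) → Fin n → Expr n
    unfoldVar [] i = var i
    unfoldVar ((a , e) ∷ ds) i with isVar a i
    ... | yes _ = unfold ds e
    ... | no _ = unfoldVar ds i

module _ {A : Set} {n : ℕ} (ρ : Vec (Poly A) n) where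

  Holds : Expr n × Expr n → Set
  Holds (a , e) = ⟦ a ⟧ ρ ≋ ⟦ e ⟧ ρ

  mutual
    unfold-sound : ∀ ds → All Holds ds → ∀ e → ⟦ e ⟧ ρ ≋ ⟦ unfold ds e ⟧ ρ
    unfold-sound ds hs (var i) = unfoldVar-sound ds hs i
    unfold-sound ds hs 𝟘ᵉ = ≋-refl
    unfold-sound ds hs 𝟙ᵉ = ≋-refl
    unfold-sound ds hs (e ⊞ f) = ⊕-cong (unfold-sound ds hs e) (unfold-sound ds hs f)
    unfold-sound ds hs (e ⊟ f) = ⊖-cong (unfold-sound ds hs e) (unfold-sound ds hs f)
    unfold-sound ds hs (e ⊠ f) = ⊗-cong (unfold-sound ds hs e) (unfold-sound ds hs f)
    unfold-sound ds hs (c ⊡ e) = sc-cong c (unfold-sound ds hs e)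

    unfoldVar-sound : ∀ ds → All Holds ds → ∀ i → lookup ρ i ≋ ⟦ unfoldVar ds i ⟧ ρ
    unfoldVar-sound [] [] i = ≋-refl
    unfoldVar-sound ((a , e) ∷ ds) (h ∷ hs) i with isVar a i
    ... | yes refl = ≋-trans h (unfold-sound ds hs e)
    ... | no _ = unfoldVar-sound ds hs i

  expand : Poly (Fin n) → Poly A
  expand = lin (mult (lookup ρ))

  nf-sound : ∀ e → ⟦ e ⟧ ρ ≋ expand (nf e)
  nf-sound (var i) = ≋-sym (≋-trans (lin-word (mult (lookup ρ)) (i ∷ [])) (⊗-identityʳ _))
  nf-sound 𝟘ᵉ = ≋-refl
  nf-sound 𝟙ᵉ = ≋-sym (lin-word (mult (lookup ρ)) [])
  nf-sound (e ⊞ f) = ≋-trans (⊕-cong (nf-sound e) (nf-sound f)) (≋-sym (lin-⊕ _ (nf e) (nf f)))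
  nf-sound (e ⊟ f) = ≋-trans (⊖-cong (nf-sound e) (nf-sound f))
    (≋-sym (≋-trans (lin-⊕ _ (nf e) _) (⊕-cong (≋-refl {P = expand (nf e)}) (lin-sc _ (- 1ℚ) (nf f)))))
  nf-sound (e ⊠ f) = ≋-trans (⊗-cong (nf-sound e) (nf-sound f))
    (≋-sym (lin-⊗ _ (mult-++ (lookup ρ)) (nf e) (nf f)))
  nf-sound (c ⊡ e) = ≋-trans (sc-cong c (nf-sound e)) (≋-sym (lin-sc _ c (nf e)))

  canonical-sound : ∀ {P Q} → canonical P ≡ canonical Q → expand P ≋ expand Q
  canonical-sound {P} {Q} eq = mk≋ λ h →
    let h′ = λ u → eval h (mult (lookup ρ) u) in
    trans (eval-lin h _ P) (trans (sym (eval-canonical h′ P))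
      (trans (cong (eval h′) eq) (trans (eval-canonical h′ Q) (sym (eval-lin h _ Q)))))

  prove : ∀ ds e₁ e₂ → All Holds ds →
          canonical (nf (unfold ds e₁)) ≡ canonical (nf (unfold ds e₂)) → ⟦ e₁ ⟧ ρ ≋ ⟦ e₂ ⟧ ρ
  prove ds e₁ e₂ hs eq =
    ≋-trans (unfold-sound ds hs e₁) (≋-trans (nf-sound (unfold ds e₁))
      (≋-trans (canonical-sound {nf (unfold ds e₁)} {nf (unfold ds e₂)} eq)
        (≋-sym (≋-trans (unfold-sound ds hs e₂) (nf-sound (unfold ds e₂))))))

solve : ∀ {A : Set} {n} (eqn : N-ary n (Expr n) (Equation n)) (ρ : Vec (Poly A) n) →
  let open Equation (_$ⁿ_ {n = n} eqn (tabulate var)) in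
  All (Holds ρ) hypotheses →
  canonical (nf (unfold hypotheses lhs)) ≡ canonical (nf (unfold hypotheses rhs)) →
  ⟦ lhs ⟧ ρ ≋ ⟦ rhs ⟧ ρ
solve {n = n} eqn ρ = let open Equation (_$ⁿ_ {n = n} eqn (tabulate var)) in prove ρ hypotheses lhs rhs

module _ {A : Set} {P Q R : Poly A} where

  isolateˡ : P ⊕ Q ≋ R → P ≋ R ⊖ Q
  isolateˡ e = solve (λ p q r → r ≔ p ⊞ q ∷ [] ⊢ p ≐ r ⊟ q) (P ∷ Q ∷ R ∷ []) (≋-sym e ∷ []) refl

  isolateʳ : P ⊕ Q ≋ R → Q ≋ R ⊖ P
  isolateʳ e = solve (λ p q r → r ≔ p ⊞ q ∷ [] ⊢ q ≐ r ⊟ p) (P ∷ Q ∷ R ∷ []) (≋-sym e ∷ []) refl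

module _ {m : ℕ} where

  private
    mod-self : ∀ (a : Fin (suc m)) → toℕ a mod suc m ≡ a
    mod-self a = Fin.toℕ-injective (trans (Fin.toℕ-fromℕ< _) (m<n⇒m%n≡m (Fin.toℕ<n a)))

  ·-identityˡ : ∀ (a : Fin (suc m)) → zero · a ≡ a
  ·-identityˡ = mod-self

  ·-identityʳ : ∀ (a : Fin (suc m)) → a · zero ≡ a
  ·-identityʳ a = trans (cong (_mod suc m) (+-identityʳ (toℕ a))) (mod-self a)

  -- η s a = a ⋄_s 1 for a letter a: ψ_s φ(x) = z_s^δ and ψ_s φ(y) = y − δ(s) y_s
  η : Fin (suc m) → L1 → Ar m
  η s x1 = Zδ s
  η s y1 = Y zero ⊖ sc (δ s) (Y s)

  data Y₁Word : List (Let m) → Set where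
    [] : Y₁Word []
    x∷_ : ∀ {w} → Y₁Word w → Y₁Word (xL ∷ w)
    y₁∷_ : ∀ {w} → Y₁Word w → Y₁Word (yL zero ∷ w)

  Y₁Word-++ : ∀ {u v} → Y₁Word u → Y₁Word v → Y₁Word (u ++ v)
  Y₁Word-++ [] v = v
  Y₁Word-++ (x∷ u) v = x∷ Y₁Word-++ u v
  Y₁Word-++ (y₁∷ u) v = y₁∷ Y₁Word-++ u v

  Y₁Poly : Ar m → Set
  Y₁Poly P = All (λ t → Y₁Word (proj₂ t)) P

  Y₁Poly-⊗ : ∀ {P Q} → Y₁Poly P → Y₁Poly Q → Y₁Poly (P ⊗ Q)
  Y₁Poly-⊗ [] Q = []
  Y₁Poly-⊗ (u ∷ P) Q = All.++⁺ (All.map⁺ (All.map (Y₁Word-++ u) Q)) (Y₁Poly-⊗ P Q)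

  φι-Y₁Poly : ∀ u → Y₁Poly (mult φL (ιw u))
  φι-Y₁Poly [] = [] ∷ []
  φι-Y₁Poly (x1 ∷ u) = Y₁Poly-⊗ {P = φL xL} ((x∷ []) ∷ (y₁∷ []) ∷ []) (φι-Y₁Poly u)
  φι-Y₁Poly (y1 ∷ u) = Y₁Poly-⊗ {P = φL (yL zero)} ((y₁∷ []) ∷ (y₁∷ []) ∷ []) (φι-Y₁Poly u)

  relabel : Fin (suc m) → Let m → Let m
  relabel s xL = xL
  relabel s (yL _) = yL s

  -- on words in x and y₁ the running products of I are all trivial, so
  -- I ∘ M_s just relabels y₁ as y_s
  I-Y₁Word : ∀ acc {w} → Y₁Word w → Iw acc w ≡ map (relabel acc) w
  I-Y₁Word acc [] = refl
  I-Y₁Word acc (x∷ w) = cong (xL ∷_) (I-Y₁Word acc w)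
  I-Y₁Word acc {yL zero ∷ w} (y₁∷ p) rewrite ·-identityʳ acc = cong (yL acc ∷_) (I-Y₁Word acc p)

  IM-Y₁Word : ∀ s {w} → Y₁Word w → Iw zero (Mw s w) ≡ map (relabel s) w
  IM-Y₁Word s [] = refl
  IM-Y₁Word s (x∷ w) = cong (xL ∷_) (IM-Y₁Word s w)
  IM-Y₁Word s {yL zero ∷ w} (y₁∷ p) rewrite ·-identityʳ s | ·-identityˡ s = cong (yL s ∷_) (I-Y₁Word s p)

  relabelled : Fin (suc m) → List (Let m) → Ar m
  relabelled s w = word (map (relabel s) w)

  relabelled-++ : ∀ s u v → relabelled s (u ++ v) ≋ relabelled s u ⊗ relabelled s v
  relabelled-++ s u v = ≋-trans (≋-reflexive (cong word (List.map-++ (relabel s) u v)))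
    (word-++ (map (relabel s) u) (map (relabel s) v))

  ψφ-letter : ∀ s a → φ (lin (relabelled s) (φL (ιL a))) ≋ η s a
  ψφ-letter s x1 = solve (λ δy x y →
      [] ⊢ 1ℚ ⊡ ((x ⊞ y) ⊠ 𝟙ᵉ) ⊞ (1ℚ ⊡ ((δy ⊟ y) ⊠ 𝟙ᵉ) ⊞ 𝟘ᵉ)
         ≐ x ⊞ δy)
    (sc (δ s) (Y s) ∷ X ∷ Y zero ∷ []) [] refl
  ψφ-letter s y1 = solve (λ δy x y →
      [] ⊢ 0ℚ ⊡ ((δy ⊟ y) ⊠ 𝟙ᵉ) ⊞ ((- 1ℚ) ⊡ ((δy ⊟ y) ⊠ 𝟙ᵉ) ⊞ 𝟘ᵉ) ≐ y ⊟ δy)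
    (sc (δ s) (Y s) ∷ X ∷ Y zero ∷ []) [] refl

  ψφι-word : ∀ s u → ψ s (φ (ι (word u))) ≋ mult (η s) u
  ψφι-word s u = begin
    φ (I (M s (φ (ι (word u)))))
      ≈⟨ lin-cong (mult φL) (lin-cong Iword (lin-cong (Mword s) φι-word)) ⟩
    φ (I (M s (mult φL (ιw u))))
      ≈⟨ lin-cong (mult φL) IM-relabels ⟩
    φ (lin (relabelled s) (mult φL (ιw u)))
      ≈⟨ lin-cong (mult φL) (lin-mult (relabelled s) ≋-refl (relabelled-++ s) φL (ιw u)) ⟩
    φ (mult (λ a → lin (relabelled s) (φL a)) (ιw u))
      ≈⟨ lin-mult (mult φL) ≋-refl (mult-++ φL) _ (ιw u) ⟩
    mult (λ a → φ (lin (relabelled s) (φL a))) (ιw u)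
      ≡⟨ mult-map (λ a → φ (lin (relabelled s) (φL a))) ιL u ⟩
    mult (λ a → φ (lin (relabelled s) (φL (ιL a)))) u
      ≈⟨ mult-cong (ψφ-letter s) u ⟩
    mult (η s) u
      ∎
    where
    open SetoidReasoning ≋-setoid
    Iword : List (Let m) → Ar m
    Iword w = word (Iw zero w)
    Mword : Fin (suc m) → List (Let m) → Ar m
    Mword s w = word (Mw s w)
    φι-word : φ (ι (word u)) ≋ mult φL (ιw u)
    φι-word = ≋-trans (lin-cong (mult φL) (lin-word (λ u → word (ιw u)) u)) (lin-word (mult φL) (ιw u))
    IM-relabels : I (M s (mult φL (ιw u))) ≋ lin (relabelled s) (mult φL (ιw u))
    IM-relabels = ≋-trans (lin-lin Iword (Mword s) (mult φL (ιw u))) (lin-ext-on _ (All.map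
      (λ {t} p → ≋-trans (lin-word Iword (Mw s (proj₂ t))) (≋-reflexive (cong word (IM-Y₁Word s p))))
      (φι-Y₁Poly u)))

  -- The defining recursion of ⋄ on reversed words

  D : Fin (suc m) → List L1 → List (Let m) → Ar m
  D s V W = dia (length V +ℕ length W) s V W

  clause : L1 → Let m → (List L1 → List (Let m) → Ar m) → List L1 → List (Let m) → Ar m
  clause x1 xL F V W = F V (xL ∷ W) ⊗ X ⊖ F (y1 ∷ V) W ⊗ X
  clause y1 xL F V W = F V (xL ∷ W) ⊗ Y zero ⊕ F (y1 ∷ V) W ⊗ X
  clause x1 (yL zero) F V W = F V (yL zero ∷ W) ⊗ X ⊕ F (x1 ∷ V) W ⊗ Y zero
  clause y1 (yL zero) F V W = F V (yL zero ∷ W) ⊗ Y zero ⊖ F (x1 ∷ V) W ⊗ Y zero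
  clause x1 (yL t@(suc _)) F V W =
    F V (yL t ∷ W) ⊗ X ⊕ (F V (xL ∷ W) ⊕ F V (yL t ∷ W)) ⊗ Y t ⊖ F (y1 ∷ V) W ⊗ Y t
  clause y1 (yL t@(suc _)) F V W =
    F V (yL t ∷ W) ⊗ Y zero ⊖ (F V (xL ∷ W) ⊕ F V (yL t ∷ W)) ⊗ Y t ⊕ F (y1 ∷ V) W ⊗ Y t

  dia-clause : ∀ n s b a V W → dia (suc n) s (b ∷ V) (a ∷ W) ≡ clause b a (dia n s) V W
  dia-clause n s x1 xL V W = refl
  dia-clause n s y1 xL V W = refl
  dia-clause n s x1 (yL zero) V W = refl
  dia-clause n s y1 (yL zero) V W = refl
  dia-clause n s x1 (yL (suc _)) V W = refl
  dia-clause n s y1 (yL (suc _)) V W = refl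

  -- clause b a F V W as a list of terms F V′ W′ ⊗ c, so that linearity in F
  -- needs no case analysis
  record Term : Set where
    constructor term
    field
      left : List L1
      right : List (Let m)
      factor : Ar m
  open Term

  size : Term → ℕ
  size t = length (left t) +ℕ length (right t)

  combine : (List L1 → List (Let m) → Ar m) → List Term → Ar m
  combine F [] = 𝟘
  combine F (term V W c ∷ ts) = F V W ⊗ c ⊕ combine F ts

  step : L1 → Let m → List L1 → List (Let m) → List Term
  step x1 xL V W = term V (xL ∷ W) X ∷ term (y1 ∷ V) W (sc (- 1ℚ) X) ∷ []
  step y1 xL V W = term V (xL ∷ W) (Y zero) ∷ term (y1 ∷ V) W X ∷ []
  step x1 (yL zero) V W = term V (yL zero ∷ W) X ∷ term (x1 ∷ V) W (Y zero) ∷ []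
  step y1 (yL zero) V W = term V (yL zero ∷ W) (Y zero) ∷ term (x1 ∷ V) W (sc (- 1ℚ) (Y zero)) ∷ []
  step x1 (yL t@(suc _)) V W =
    term V (yL t ∷ W) X ∷ term V (xL ∷ W) (Y t) ∷ term V (yL t ∷ W) (Y t)
    ∷ term (y1 ∷ V) W (sc (- 1ℚ) (Y t)) ∷ []
  step y1 (yL t@(suc _)) V W =
    term V (yL t ∷ W) (Y zero) ∷ term V (xL ∷ W) (sc (- 1ℚ) (Y t)) ∷ term V (yL t ∷ W) (sc (- 1ℚ) (Y t))
    ∷ term (y1 ∷ V) W (Y t) ∷ []

  clause-combine : ∀ b a F V W → clause b a F V W ≋ combine F (step b a V W)
  clause-combine x1 xL F V W = solve (λ p q x → [] ⊢ p ⊠ x ⊟ q ⊠ x ≐ p ⊠ x ⊞ (q ⊠ ((- 1ℚ) ⊡ x) ⊞ 𝟘ᵉ))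
    (F V (xL ∷ W) ∷ F (y1 ∷ V) W ∷ X ∷ []) [] refl
  clause-combine y1 xL F V W = solve (λ p q x y → [] ⊢ p ⊠ y ⊞ q ⊠ x ≐ p ⊠ y ⊞ (q ⊠ x ⊞ 𝟘ᵉ))
    (F V (xL ∷ W) ∷ F (y1 ∷ V) W ∷ X ∷ Y zero ∷ []) [] refl
  clause-combine x1 (yL zero) F V W = solve (λ p q x y → [] ⊢ p ⊠ x ⊞ q ⊠ y ≐ p ⊠ x ⊞ (q ⊠ y ⊞ 𝟘ᵉ))
    (F V (yL zero ∷ W) ∷ F (x1 ∷ V) W ∷ X ∷ Y zero ∷ []) [] refl
  clause-combine y1 (yL zero) F V W = solve (λ p q y → [] ⊢ p ⊠ y ⊟ q ⊠ y ≐ p ⊠ y ⊞ (q ⊠ ((- 1ℚ) ⊡ y) ⊞ 𝟘ᵉ))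
    (F V (yL zero ∷ W) ∷ F (x1 ∷ V) W ∷ Y zero ∷ []) [] refl
  clause-combine x1 (yL t@(suc _)) F V W = solve (λ p p′ q x yₜ →
      [] ⊢ p ⊠ x ⊞ (p′ ⊞ p) ⊠ yₜ ⊟ q ⊠ yₜ
         ≐ p ⊠ x ⊞ (p′ ⊠ yₜ ⊞ (p ⊠ yₜ ⊞ (q ⊠ ((- 1ℚ) ⊡ yₜ) ⊞ 𝟘ᵉ))))
    (F V (yL t ∷ W) ∷ F V (xL ∷ W) ∷ F (y1 ∷ V) W ∷ X ∷ Y t ∷ []) [] refl
  clause-combine y1 (yL t@(suc _)) F V W = solve (λ p p′ q y yₜ →
      [] ⊢ p ⊠ y ⊟ (p′ ⊞ p) ⊠ yₜ ⊞ q ⊠ yₜ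
         ≐ p ⊠ y ⊞ (p′ ⊠ ((- 1ℚ) ⊡ yₜ) ⊞ (p ⊠ ((- 1ℚ) ⊡ yₜ) ⊞ (q ⊠ yₜ ⊞ 𝟘ᵉ))))
    (F V (yL t ∷ W) ∷ F V (xL ∷ W) ∷ F (y1 ∷ V) W ∷ Y zero ∷ Y t ∷ []) [] refl

  step-size : ∀ b a V W → All (λ t → size t ≡ length V +ℕ suc (length W)) (step b a V W)
  step-size x1 xL V W = refl ∷ sym (+-suc _ _) ∷ []
  step-size y1 xL V W = refl ∷ sym (+-suc _ _) ∷ []
  step-size x1 (yL zero) V W = refl ∷ sym (+-suc _ _) ∷ []
  step-size y1 (yL zero) V W = refl ∷ sym (+-suc _ _) ∷ []
  step-size x1 (yL (suc _)) V W = refl ∷ refl ∷ refl ∷ sym (+-suc _ _) ∷ []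
  step-size y1 (yL (suc _)) V W = refl ∷ refl ∷ refl ∷ sym (+-suc _ _) ∷ []

  combine-fuel : ∀ {n} s {ts} → All (λ t → size t ≡ n) ts → combine (dia n s) ts ≡ combine (D s) ts
  combine-fuel s [] = refl
  combine-fuel s {term V W c ∷ _} (e ∷ es) = cong₂ (λ k R → dia k s V W ⊗ c ⊕ R) (sym e) (combine-fuel s es)

  Solution : (List L1 → List (Let m) → Ar m) → Set
  Solution F = ∀ b a V W → F (b ∷ V) (a ∷ W) ≋ combine F (step b a V W)

  D-step : ∀ s → Solution (D s)
  D-step s b a V W = ≋-trans (≋-reflexive (dia-clause (length V +ℕ suc (length W)) s b a V W))
    (≋-trans (clause-combine b a _ V W) (≋-reflexive (combine-fuel s (step-size b a V W))))

  D-clause : ∀ s b a V W → D s (b ∷ V) (a ∷ W) ≋ clause b a (D s) V W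
  D-clause s b a V W = ≋-trans (D-step s b a V W) (≋-sym (clause-combine b a (D s) V W))

  combine-vanishes : ∀ {F} ts → All (λ t → F (left t) (right t) ≋ 𝟘) ts → combine F ts ≋ 𝟘
  combine-vanishes [] [] = ≋-refl
  combine-vanishes {F} (term V W c ∷ ts) (p ∷ ps) =
    solve (λ f c r → f ≔ 𝟘ᵉ ∷ r ≔ 𝟘ᵉ ∷ [] ⊢ f ⊠ c ⊞ r ≐ 𝟘ᵉ)
      (F V W ∷ c ∷ combine F ts ∷ []) (p ∷ combine-vanishes ts ps ∷ []) refl

  solution-vanishes : ∀ {F} → Solution F → (∀ V → F V [] ≋ 𝟘) → (∀ W → F [] W ≋ 𝟘) → ∀ V W → F V W ≋ 𝟘
  solution-vanishes {F} sol empty₂ empty₁ V W = go _ V W refl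
    where
    go : ∀ n V W → length V +ℕ length W ≡ n → F V W ≋ 𝟘
    go n [] W _ = empty₁ W
    go n (b ∷ V) [] _ = empty₂ (b ∷ V)
    go (suc n) (b ∷ V) (a ∷ W) e = ≋-trans (sol b a V W) (combine-vanishes (step b a V W)
      (All.map (λ {t} e′ → go n (left t) (right t) (trans e′ (suc-injective e))) (step-size b a V W)))

  combine-linear : ∀ L (G H : List L1 → List (Let m) → Ar m) ts →
    combine (λ V W → L ⊗ G V W ⊕ H V W) ts ≋ L ⊗ combine G ts ⊕ combine H ts
  combine-linear L G H [] = solve (λ l → [] ⊢ 𝟘ᵉ ≐ l ⊠ 𝟘ᵉ ⊞ 𝟘ᵉ) (L ∷ []) [] refl
  combine-linear L G H (term V W c ∷ ts) =
    solve (λ l g h c r rG rH → r ≔ l ⊠ rG ⊞ rH ∷ [] ⊢ (l ⊠ g ⊞ h) ⊠ c ⊞ r ≐ l ⊠ (g ⊠ c ⊞ rG) ⊞ (h ⊠ c ⊞ rH))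
      (L ∷ G V W ∷ H V W ∷ c ∷ combine (λ V W → L ⊗ G V W ⊕ H V W) ts ∷ combine G ts ∷ combine H ts ∷ [])
      (combine-linear L G H ts ∷ []) refl

  mult-reverse-∷ : ∀ (g : L1 → Ar m) a V → mult g (reverse (a ∷ V)) ≋ mult g (reverse V) ⊗ g a
  mult-reverse-∷ g a V = ≋-trans (≋-reflexive (cong (mult g) (List.unfold-reverse a V)))
    (≋-trans (mult-++ g (reverse V) (a ∷ [])) (⊗-cong (≋-refl {P = mult g (reverse V)}) (⊗-identityʳ (g a))))

  mult-reverse-∷ʳ : ∀ (g : L1 → Ar m) a V → mult g (reverse (V ++ a ∷ [])) ≡ g a ⊗ mult g (reverse V)
  mult-reverse-∷ʳ g a V = cong (mult g) (List.reverse-++ V (a ∷ []))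

  D-empty : ∀ (s : Fin (suc m)) V → D s V [] ≋ mult (η s) (reverse V)
  D-empty s [] = ≋-refl
  D-empty s (a ∷ V) = ψφι-word s (reverse (a ∷ V))

  D-empty-∷ : ∀ (s : Fin (suc m)) a V → D s (a ∷ V) [] ≋ D s V [] ⊗ η s a
  D-empty-∷ s a V = ≋-trans (D-empty s (a ∷ V)) (≋-trans (mult-reverse-∷ (η s) a V)
    (⊗-cong (≋-sym (D-empty s V)) (≋-refl {P = η s a})))

  D-empty-∷ʳ : ∀ (s : Fin (suc m)) a V → D s (V ++ a ∷ []) [] ≋ η s a ⊗ D s V []
  D-empty-∷ʳ s a V = ≋-trans (D-empty s (V ++ a ∷ [])) (≋-trans (≋-reflexive (mult-reverse-∷ʳ (η s) a V))
    (⊗-cong (≋-refl {P = η s a}) (≋-sym (D-empty s V))))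

  D-letter : ∀ (s : Fin (suc m)) a → D s (a ∷ []) [] ≋ η s a
  D-letter s a = ≋-trans (D-empty-∷ʳ s a []) (⊗-identityʳ (η s a))

  rword : List (Let m) → Ar m
  rword W = word (reverse W)

  rword-∷ : ∀ c W → rword (c ∷ W) ≋ rword W ⊗ letter c
  rword-∷ c W = ≋-trans (≋-reflexive (cong word (List.unfold-reverse c W))) (word-++ (reverse W) (c ∷ []))

  rword-∷ʳ : ∀ c W → rword (W ++ c ∷ []) ≋ letter c ⊗ rword W
  rword-∷ʳ c W = ≋-trans (≋-reflexive (cong word (List.reverse-++ W (c ∷ [])))) (word-++ (c ∷ []) (reverse W))

  D-zˡ : ∀ (s : Fin (suc m)) V W → D s (x1 ∷ V) W ⊕ D s (y1 ∷ V) W ≋ D s V W ⊗ Z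
  D-zˡ s V [] = solve (λ dx dy d δy x y →
      dx ≔ d ⊠ (x ⊞ δy) ∷ dy ≔ d ⊠ (y ⊟ δy) ∷ [] ⊢ dx ⊞ dy ≐ d ⊠ (x ⊞ y))
    (D s (x1 ∷ V) [] ∷ D s (y1 ∷ V) [] ∷ D s V [] ∷ sc (δ s) (Y s) ∷ X ∷ Y zero ∷ [])
    (D-empty-∷ s x1 V ∷ D-empty-∷ s y1 V ∷ []) refl
  D-zˡ s V (xL ∷ W) = solve (λ dx dy p q x y →
      dx ≔ p ⊠ x ⊟ q ⊠ x ∷ dy ≔ p ⊠ y ⊞ q ⊠ x ∷ [] ⊢ dx ⊞ dy ≐ p ⊠ (x ⊞ y))
    (D s (x1 ∷ V) (xL ∷ W) ∷ D s (y1 ∷ V) (xL ∷ W) ∷ D s V (xL ∷ W) ∷ D s (y1 ∷ V) W ∷ X ∷ Y zero ∷ [])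
    (D-clause s x1 xL V W ∷ D-clause s y1 xL V W ∷ []) refl
  D-zˡ s V (yL zero ∷ W) = solve (λ dx dy p q x y →
      dx ≔ p ⊠ x ⊞ q ⊠ y ∷ dy ≔ p ⊠ y ⊟ q ⊠ y ∷ [] ⊢ dx ⊞ dy ≐ p ⊠ (x ⊞ y))
    (D s (x1 ∷ V) (yL zero ∷ W) ∷ D s (y1 ∷ V) (yL zero ∷ W) ∷ D s V (yL zero ∷ W) ∷ D s (x1 ∷ V) W ∷ X ∷ Y zero ∷ [])
    (D-clause s x1 (yL zero) V W ∷ D-clause s y1 (yL zero) V W ∷ []) refl
  D-zˡ s V (yL t@(suc _) ∷ W) = solve (λ dx dy p p′ q x y yₜ →
      dx ≔ p ⊠ x ⊞ (p′ ⊞ p) ⊠ yₜ ⊟ q ⊠ yₜ ∷ dy ≔ p ⊠ y ⊟ (p′ ⊞ p) ⊠ yₜ ⊞ q ⊠ yₜ ∷ []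
      ⊢ dx ⊞ dy ≐ p ⊠ (x ⊞ y))
    (D s (x1 ∷ V) (yL t ∷ W) ∷ D s (y1 ∷ V) (yL t ∷ W) ∷ D s V (yL t ∷ W) ∷ D s V (xL ∷ W) ∷ D s (y1 ∷ V) W
      ∷ X ∷ Y zero ∷ Y t ∷ [])
    (D-clause s x1 (yL t) V W ∷ D-clause s y1 (yL t) V W ∷ []) refl

  D-xˡ : ∀ (s : Fin (suc m)) V W → D s (x1 ∷ V) W ≋ D s V W ⊗ Z ⊖ D s (y1 ∷ V) W
  D-xˡ s V W = isolateˡ (D-zˡ s V W)

  D-yˡ : ∀ (s : Fin (suc m)) V W → D s (y1 ∷ V) W ≋ D s V W ⊗ Z ⊖ D s (x1 ∷ V) W
  D-yˡ s V W = isolateʳ (D-zˡ s V W)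

  D-zʳ : ∀ (s : Fin (suc m)) V W → D s V (xL ∷ W) ⊕ D s V (yL zero ∷ W) ≋ D s V W ⊗ Z
  D-zʳ s [] W = solve (λ wx wy w x y →
      wx ≔ w ⊠ x ∷ wy ≔ w ⊠ y ∷ [] ⊢ wx ⊞ wy ≐ w ⊠ (x ⊞ y))
    (rword (xL ∷ W) ∷ rword (yL zero ∷ W) ∷ rword W ∷ X ∷ Y zero ∷ [])
    (rword-∷ xL W ∷ rword-∷ (yL zero) W ∷ []) refl
  D-zʳ s (x1 ∷ V) W = solve (λ dxx dxy p q p′ dx d x y →
      dxx ≔ p ⊠ x ⊟ q ⊠ x ∷ dxy ≔ p′ ⊠ x ⊞ dx ⊠ y ∷
      q ≔ d ⊠ (x ⊞ y) ⊟ dx ∷ p′ ≔ d ⊠ (x ⊞ y) ⊟ p ∷ [] ⊢ dxx ⊞ dxy ≐ dx ⊠ (x ⊞ y))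
    (D s (x1 ∷ V) (xL ∷ W) ∷ D s (x1 ∷ V) (yL zero ∷ W) ∷ D s V (xL ∷ W) ∷ D s (y1 ∷ V) W
      ∷ D s V (yL zero ∷ W) ∷ D s (x1 ∷ V) W ∷ D s V W ∷ X ∷ Y zero ∷ [])
    (D-clause s x1 xL V W ∷ D-clause s x1 (yL zero) V W ∷ D-yˡ s V W ∷ isolateʳ (D-zʳ s V W) ∷ []) refl
  D-zʳ s (y1 ∷ V) W = solve (λ dyx dyy p dy p′ q d x y →
      dyx ≔ p ⊠ y ⊞ dy ⊠ x ∷ dyy ≔ p′ ⊠ y ⊟ q ⊠ y ∷
      p′ ≔ d ⊠ (x ⊞ y) ⊟ p ∷ q ≔ d ⊠ (x ⊞ y) ⊟ dy ∷ [] ⊢ dyx ⊞ dyy ≐ dy ⊠ (x ⊞ y))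
    (D s (y1 ∷ V) (xL ∷ W) ∷ D s (y1 ∷ V) (yL zero ∷ W) ∷ D s V (xL ∷ W) ∷ D s (y1 ∷ V) W
      ∷ D s V (yL zero ∷ W) ∷ D s (x1 ∷ V) W ∷ D s V W ∷ X ∷ Y zero ∷ [])
    (D-clause s y1 xL V W ∷ D-clause s y1 (yL zero) V W ∷ isolateʳ (D-zʳ s V W) ∷ D-xˡ s V W ∷ []) refl

  D-yʳ : ∀ (s : Fin (suc m)) V W → D s V (yL zero ∷ W) ≋ D s V W ⊗ Z ⊖ D s V (xL ∷ W)
  D-yʳ s V W = isolateʳ (D-zʳ s V W)

  ρ : Let m → Ar m
  ρ xL = X ⊗ Y zero
  ρ (yL zero) = sc (- 1ℚ) (X ⊗ Y zero)
  ρ (yL t@(suc _)) = Y t ⊗ Y zero ⊖ (X ⊕ Y t) ⊗ Y t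

  D-y-∷ : ∀ (s : Fin (suc m)) c W → D s (y1 ∷ []) (c ∷ W) ≋ D s (y1 ∷ []) W ⊗ letter c ⊕ rword W ⊗ ρ c
  D-y-∷ s xL W = solve (λ d wx dw w x y →
      d ≔ wx ⊠ y ⊞ dw ⊠ x ∷ wx ≔ w ⊠ x ∷ [] ⊢ d ≐ dw ⊠ x ⊞ w ⊠ (x ⊠ y))
    (D s (y1 ∷ []) (xL ∷ W) ∷ rword (xL ∷ W) ∷ D s (y1 ∷ []) W ∷ rword W ∷ X ∷ Y zero ∷ [])
    (D-clause s y1 xL [] W ∷ rword-∷ xL W ∷ []) refl
  D-y-∷ s (yL zero) W = solve (λ d wy dx dw w x y →
      d ≔ wy ⊠ y ⊟ dx ⊠ y ∷ wy ≔ w ⊠ y ∷ dx ≔ w ⊠ (x ⊞ y) ⊟ dw ∷ []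
      ⊢ d ≐ dw ⊠ y ⊞ w ⊠ ((- 1ℚ) ⊡ (x ⊠ y)))
    (D s (y1 ∷ []) (yL zero ∷ W) ∷ rword (yL zero ∷ W) ∷ D s (x1 ∷ []) W ∷ D s (y1 ∷ []) W ∷ rword W
      ∷ X ∷ Y zero ∷ [])
    (D-clause s y1 (yL zero) [] W ∷ rword-∷ (yL zero) W ∷ D-xˡ s [] W ∷ []) refl
  D-y-∷ s (yL t@(suc _)) W = solve (λ d wyₜ wx dw w x y yₜ →
      d ≔ wyₜ ⊠ y ⊟ (wx ⊞ wyₜ) ⊠ yₜ ⊞ dw ⊠ yₜ
      ∷ wyₜ ≔ w ⊠ yₜ ∷ wx ≔ w ⊠ x ∷ [] ⊢ d ≐ dw ⊠ yₜ ⊞ w ⊠ (yₜ ⊠ y ⊟ (x ⊞ yₜ) ⊠ yₜ))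
    (D s (y1 ∷ []) (yL t ∷ W) ∷ rword (yL t ∷ W) ∷ rword (xL ∷ W) ∷ D s (y1 ∷ []) W ∷ rword W
      ∷ X ∷ Y zero ∷ Y t ∷ [])
    (D-clause s y1 (yL t) [] W ∷ rword-∷ (yL t) W ∷ rword-∷ xL W ∷ []) refl

  -- Vanishing combinations of shifted diamonds

  D-++[]₁ : ∀ (s : Fin (suc m)) V W → D s (V ++ []) W ≋ D s V W
  D-++[]₁ s V W = ≋-reflexive (cong (λ V → D s V W) (List.++-identityʳ V))

  D-++[]₂ : ∀ (s : Fin (suc m)) V W → D s V (W ++ []) ≋ D s V W
  D-++[]₂ s V W = ≋-reflexive (cong (D s V) (List.++-identityʳ W))

  rword-++[] : ∀ (W : List (Let m)) → rword (W ++ []) ≋ rword W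
  rword-++[] W = ≋-reflexive (cong rword (List.++-identityʳ W))

  -- shift L σ p q stands for L ⊗ (p̃ v ⋄_σ q̃ w), p̃ and q̃ the reversals of p and q
  record Shift : Set where
    constructor shift
    field
      factor : Ar m
      param : Fin (suc m)
      prefix₁ : List L1
      prefix₂ : List (Let m)

  shifted : List Shift → List L1 → List (Let m) → Ar m
  shifted [] V W = 𝟘
  shifted (shift L σ p q ∷ ts) V W = L ⊗ D σ (V ++ p) (W ++ q) ⊕ shifted ts V W

  step-++ : ∀ (F : List L1 → List (Let m) → Ar m) b a V W p q →
    combine F (step b a (V ++ p) (W ++ q)) ≡ combine (λ V′ W′ → F (V′ ++ p) (W′ ++ q)) (step b a V W)
  step-++ F x1 xL V W p q = refl
  step-++ F y1 xL V W p q = refl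
  step-++ F x1 (yL zero) V W p q = refl
  step-++ F y1 (yL zero) V W p q = refl
  step-++ F x1 (yL (suc _)) V W p q = refl
  step-++ F y1 (yL (suc _)) V W p q = refl

  shifted-solution : ∀ ts → Solution (shifted ts)
  shifted-solution [] b a V W = ≋-sym (combine-vanishes (step b a V W) (All.tabulate λ _ → ≋-refl))
  shifted-solution (shift L σ p q ∷ ts) b a V W =
    ≋-trans (⊕-cong (⊗-cong (≋-refl {P = L}) (D-step σ b a (V ++ p) (W ++ q))) (shifted-solution ts b a V W))
      (≋-trans (≋-reflexive (cong (λ R → L ⊗ R ⊕ combine (shifted ts) (step b a V W)) (step-++ (D σ) b a V W p q)))
        (≋-sym (combine-linear L (λ V W → D σ (V ++ p) (W ++ q)) (shifted ts) (step b a V W))))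

  shifted-xˡ : ∀ ts V W → shifted ts (x1 ∷ V) W ≋ shifted ts V W ⊗ Z ⊖ shifted ts (y1 ∷ V) W
  shifted-xˡ [] V W = solve (λ x y → [] ⊢ 𝟘ᵉ ≐ 𝟘ᵉ ⊠ (x ⊞ y) ⊟ 𝟘ᵉ) (X ∷ Y zero ∷ []) [] refl
  shifted-xˡ (shift L σ p q ∷ ts) V W = solve (λ l dx d dy rx r ry x y →
      dx ≔ d ⊠ (x ⊞ y) ⊟ dy ∷ rx ≔ r ⊠ (x ⊞ y) ⊟ ry ∷ []
      ⊢ l ⊠ dx ⊞ rx ≐ (l ⊠ d ⊞ r) ⊠ (x ⊞ y) ⊟ (l ⊠ dy ⊞ ry))
    (L ∷ D σ (x1 ∷ V ++ p) (W ++ q) ∷ D σ (V ++ p) (W ++ q) ∷ D σ (y1 ∷ V ++ p) (W ++ q)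
      ∷ shifted ts (x1 ∷ V) W ∷ shifted ts V W ∷ shifted ts (y1 ∷ V) W ∷ X ∷ Y zero ∷ [])
    (D-xˡ σ (V ++ p) (W ++ q) ∷ shifted-xˡ ts V W ∷ []) refl

  shifted-vanishes : ∀ ts → (∀ V → shifted ts V [] ≋ 𝟘) → (∀ W → shifted ts [] W ≋ 𝟘) →
                     ∀ V W → shifted ts V W ≋ 𝟘
  shifted-vanishes ts = solution-vanishes (shifted-solution ts)

  empty₁-vanishes : ∀ ts → shifted ts [] [] ≋ 𝟘 →
    (∀ c W → shifted ts [] (c ∷ W) ≋ shifted ts [] W ⊗ letter c) → ∀ W → shifted ts [] W ≋ 𝟘
  empty₁-vanishes ts base step [] = base
  empty₁-vanishes ts base step (c ∷ W) = ≋-trans (step c W) (solve (λ r c → r ≔ 𝟘ᵉ ∷ [] ⊢ r ⊠ c ≐ 𝟘ᵉ)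
    (shifted ts [] W ∷ letter c ∷ []) (empty₁-vanishes ts base step W ∷ []) refl)

  empty₂-vanishes : ∀ ts t → shifted ts [] [] ≋ 𝟘 →
    (∀ V → shifted ts (y1 ∷ V) [] ≋ shifted ts V [] ⊗ η t y1) → ∀ V → shifted ts V [] ≋ 𝟘
  empty₂-vanishes ts t base step = vanish
    where
    vanish : ∀ V → shifted ts V [] ≋ 𝟘
    vanish-y : ∀ V → shifted ts (y1 ∷ V) [] ≋ 𝟘
    vanish [] = base
    vanish (y1 ∷ V) = vanish-y V
    vanish (x1 ∷ V) = ≋-trans (shifted-xˡ ts V [])
      (solve (λ r ry x y → r ≔ 𝟘ᵉ ∷ ry ≔ 𝟘ᵉ ∷ [] ⊢ r ⊠ (x ⊞ y) ⊟ ry ≐ 𝟘ᵉ)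
        (shifted ts V [] ∷ shifted ts (y1 ∷ V) [] ∷ X ∷ Y zero ∷ []) (vanish V ∷ vanish-y V ∷ []) refl)
    vanish-y V = ≋-trans (step V) (solve (λ r f → r ≔ 𝟘ᵉ ∷ [] ⊢ r ⊠ f ≐ 𝟘ᵉ)
      (shifted ts V [] ∷ η t y1 ∷ []) (vanish V ∷ []) refl)

  -- In the normaliser calls below an atom dA∣B (eA∣B) stands for D s A B (D t A B),
  -- written with the variable words V, W and the letters appended to them, ∅
  -- marking an appended []; f is η s y1 and δy is δ(s) y_s.
  terms-yz : Fin (suc m) → List Shift
  terms-yz s =
    shift 𝟙 s (y1 ∷ []) (xL ∷ []) ∷ shift 𝟙 s (y1 ∷ []) (yL zero ∷ [])
    ∷ shift (sc (- 1ℚ) (η s y1)) s [] (xL ∷ []) ∷ shift (sc (- 1ℚ) (η s y1)) s [] (yL zero ∷ [])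
    ∷ shift (sc (- 1ℚ) Z) s (y1 ∷ []) [] ∷ shift (Z ⊗ η s y1) s [] [] ∷ []

  terms-yz-empty₂ : ∀ s V → shifted (terms-yz s) V [] ≋ 𝟘
  terms-yz-empty₂ s V = solve (λ dVy∣x dVy∣y dV∅∣x dV∅∣y dVy∣∅ dV∅∣∅ f dV∣∅ x y →
      dVy∣y ≔ dVy∣∅ ⊠ (x ⊞ y) ⊟ dVy∣x ∷
      dV∅∣y ≔ dV∅∣∅ ⊠ (x ⊞ y) ⊟ dV∅∣x ∷
      dVy∣∅ ≔ f ⊠ dV∣∅ ∷
      dV∅∣∅ ≔ dV∣∅ ∷
      [] ⊢ Σᵉ (𝟙ᵉ ∙ dVy∣x ∷ 𝟙ᵉ ∙ dVy∣y ∷ (- 1ℚ) ⊡ f ∙ dV∅∣x ∷ (- 1ℚ) ⊡ f ∙ dV∅∣y ∷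
              (- 1ℚ) ⊡ (x ⊞ y) ∙ dVy∣∅ ∷ (x ⊞ y) ⊠ f ∙ dV∅∣∅ ∷ [])
         ≐ 𝟘ᵉ)
    (D s (V ++ y1 ∷ []) (xL ∷ []) ∷ D s (V ++ y1 ∷ []) (yL zero ∷ []) ∷ D s (V ++ []) (xL ∷ []) ∷
      D s (V ++ []) (yL zero ∷ []) ∷ D s (V ++ y1 ∷ []) [] ∷ D s (V ++ []) [] ∷ η s y1 ∷ D s V [] ∷ X ∷
      Y zero ∷ [])
    (D-yʳ s (V ++ y1 ∷ []) [] ∷ D-yʳ s (V ++ []) [] ∷ D-empty-∷ʳ s y1 V ∷ D-++[]₁ s V [] ∷ []) refl

  terms-yz-∷₂ : ∀ s c W → shifted (terms-yz s) [] (c ∷ W) ≋ shifted (terms-yz s) [] W ⊗ letter c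
  terms-yz-∷₂ s c W = solve (λ dy∣cWx dy∣cWy d∅∣cWx d∅∣cWy dy∣cW∅ d∅∣cW∅ dy∣Wx dy∣Wy d∅∣Wx d∅∣Wy dy∣W∅
                               d∅∣W∅ f w ρc x y c →
      dy∣cWx ≔ dy∣Wx ⊠ c ⊞ d∅∣Wx ⊠ ρc ∷
      dy∣cWy ≔ dy∣Wy ⊠ c ⊞ d∅∣Wy ⊠ ρc ∷
      d∅∣cWx ≔ d∅∣Wx ⊠ c ∷
      d∅∣cWy ≔ d∅∣Wy ⊠ c ∷
      dy∣cW∅ ≔ dy∣W∅ ⊠ c ⊞ d∅∣W∅ ⊠ ρc ∷
      d∅∣cW∅ ≔ d∅∣W∅ ⊠ c ∷
      d∅∣Wx ≔ x ⊠ w ∷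
      d∅∣Wy ≔ y ⊠ w ∷
      d∅∣W∅ ≔ w ∷
      [] ⊢ Σᵉ (𝟙ᵉ ∙ dy∣cWx ∷ 𝟙ᵉ ∙ dy∣cWy ∷ (- 1ℚ) ⊡ f ∙ d∅∣cWx ∷ (- 1ℚ) ⊡ f ∙ d∅∣cWy ∷
              (- 1ℚ) ⊡ (x ⊞ y) ∙ dy∣cW∅ ∷ (x ⊞ y) ⊠ f ∙ d∅∣cW∅ ∷ [])
         ≐ Σᵉ (𝟙ᵉ ∙ dy∣Wx ∷ 𝟙ᵉ ∙ dy∣Wy ∷ (- 1ℚ) ⊡ f ∙ d∅∣Wx ∷ (- 1ℚ) ⊡ f ∙ d∅∣Wy ∷
              (- 1ℚ) ⊡ (x ⊞ y) ∙ dy∣W∅ ∷ (x ⊞ y) ⊠ f ∙ d∅∣W∅ ∷ []) ⊠ c)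
    (D s (y1 ∷ []) ((c ∷ W) ++ xL ∷ []) ∷ D s (y1 ∷ []) ((c ∷ W) ++ yL zero ∷ []) ∷
      D s [] ((c ∷ W) ++ xL ∷ []) ∷ D s [] ((c ∷ W) ++ yL zero ∷ []) ∷ D s (y1 ∷ []) ((c ∷ W) ++ []) ∷
      D s [] ((c ∷ W) ++ []) ∷ D s (y1 ∷ []) (W ++ xL ∷ []) ∷ D s (y1 ∷ []) (W ++ yL zero ∷ []) ∷
      D s [] (W ++ xL ∷ []) ∷ D s [] (W ++ yL zero ∷ []) ∷ D s (y1 ∷ []) (W ++ []) ∷ D s [] (W ++ []) ∷
      η s y1 ∷ rword W ∷ ρ c ∷ X ∷ Y zero ∷ letter c ∷ [])
    (D-y-∷ s c (W ++ xL ∷ []) ∷ D-y-∷ s c (W ++ yL zero ∷ []) ∷ rword-∷ c (W ++ xL ∷ []) ∷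
      rword-∷ c (W ++ yL zero ∷ []) ∷ D-y-∷ s c (W ++ []) ∷ rword-∷ c (W ++ []) ∷ rword-∷ʳ xL W ∷
      rword-∷ʳ (yL zero) W ∷ rword-++[] W ∷ []) refl

  terms-yz-vanish : ∀ s V W → shifted (terms-yz s) V W ≋ 𝟘
  terms-yz-vanish s = shifted-vanishes (terms-yz s) (terms-yz-empty₂ s)
    (empty₁-vanishes (terms-yz s) (terms-yz-empty₂ s []) (terms-yz-∷₂ s))

  terms-yzδ : Fin (suc m) → Fin (suc m) → List Shift
  terms-yzδ s zero =
    shift 𝟙 s (y1 ∷ []) (xL ∷ []) ∷ shift (sc (- 1ℚ) (η s y1)) s [] (xL ∷ [])
    ∷ shift (sc (- 1ℚ) X) zero (y1 ∷ []) [] ∷ []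
  terms-yzδ s t@(suc _) =
    shift 𝟙 s (y1 ∷ []) (xL ∷ []) ∷ shift 𝟙 s (y1 ∷ []) (yL t ∷ [])
    ∷ shift (sc (- 1ℚ) (η s y1)) s [] (xL ∷ []) ∷ shift (sc (- 1ℚ) (η s y1)) s [] (yL t ∷ [])
    ∷ shift (sc (- 1ℚ) (Zδ t)) t (y1 ∷ []) [] ∷ []

  terms-yzδ-empty : ∀ s t → shifted (terms-yzδ s t) [] [] ≋ 𝟘
  terms-yzδ-empty s t@(suc _) = solve (λ dy∣x dy∣t ey∣∅ f dy∣∅ x y yₜ →
      dy∣x ≔ x ⊠ y ⊞ dy∣∅ ⊠ x ∷
      dy∣t ≔ yₜ ⊠ y ⊟ (x ⊞ yₜ) ⊠ yₜ ⊞ dy∣∅ ⊠ yₜ ∷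
      ey∣∅ ≔ y ⊟ 1ℚ ⊡ yₜ ∷
      dy∣∅ ≔ f ∷
      [] ⊢ Σᵉ (𝟙ᵉ ∙ dy∣x ∷ 𝟙ᵉ ∙ dy∣t ∷ (- 1ℚ) ⊡ f ∙ x ∷ (- 1ℚ) ⊡ f ∙ yₜ ∷
              (- 1ℚ) ⊡ (x ⊞ 1ℚ ⊡ yₜ) ∙ ey∣∅ ∷ [])
         ≐ 𝟘ᵉ)
    (D s (y1 ∷ []) (xL ∷ []) ∷ D s (y1 ∷ []) (yL t ∷ []) ∷ D t (y1 ∷ []) [] ∷ η s y1 ∷
      D s (y1 ∷ []) [] ∷ X ∷ Y zero ∷ Y t ∷ [])
    (D-clause s y1 xL [] [] ∷ D-clause s y1 (yL t) [] [] ∷ D-letter t y1 ∷ D-letter s y1 ∷ []) refl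
  terms-yzδ-empty s zero = solve (λ dy∣x ey∣∅ f dy∣∅ x y →
      dy∣x ≔ x ⊠ y ⊞ dy∣∅ ⊠ x ∷
      ey∣∅ ≔ y ⊟ 0ℚ ⊡ y ∷
      dy∣∅ ≔ f ∷
      [] ⊢ Σᵉ (𝟙ᵉ ∙ dy∣x ∷ (- 1ℚ) ⊡ f ∙ x ∷ (- 1ℚ) ⊡ x ∙ ey∣∅ ∷ [])
         ≐ 𝟘ᵉ)
    (D s (y1 ∷ []) (xL ∷ []) ∷ D zero (y1 ∷ []) [] ∷ η s y1 ∷ D s (y1 ∷ []) [] ∷ X ∷ Y zero ∷ [])
    (D-clause s y1 xL [] [] ∷ D-letter zero y1 ∷ D-letter s y1 ∷ []) refl

  terms-yzδ-y∷₁ : ∀ s t V → shifted (terms-yzδ s t) (y1 ∷ V) [] ≋ shifted (terms-yzδ s t) V [] ⊗ η t y1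
  terms-yzδ-y∷₁ s t@(suc _) V = solve (λ dyVy∣x dyVy∣t dyV∅∣x dyV∅∣t eyVy∣∅ dVy∣x dVy∣t dV∅∣x dV∅∣t eVy∣∅ f
                                         dyVy∣∅ dyV∅∣∅ dyV∣∅ x y yₜ →
      dyVy∣x ≔ dVy∣x ⊠ y ⊞ dyVy∣∅ ⊠ x ∷
      dyVy∣t ≔ dVy∣t ⊠ y ⊟ (dVy∣x ⊞ dVy∣t) ⊠ yₜ ⊞ dyVy∣∅ ⊠ yₜ ∷
      dyV∅∣x ≔ dV∅∣x ⊠ y ⊞ dyV∅∣∅ ⊠ x ∷
      dyV∅∣t ≔ dV∅∣t ⊠ y ⊟ (dV∅∣x ⊞ dV∅∣t) ⊠ yₜ ⊞ dyV∅∣∅ ⊠ yₜ ∷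
      eyVy∣∅ ≔ eVy∣∅ ⊠ (y ⊟ 1ℚ ⊡ yₜ) ∷
      dyVy∣∅ ≔ f ⊠ dyV∣∅ ∷
      dyV∅∣∅ ≔ dyV∣∅ ∷
      [] ⊢ Σᵉ (𝟙ᵉ ∙ dyVy∣x ∷ 𝟙ᵉ ∙ dyVy∣t ∷ (- 1ℚ) ⊡ f ∙ dyV∅∣x ∷ (- 1ℚ) ⊡ f ∙ dyV∅∣t ∷
              (- 1ℚ) ⊡ (x ⊞ 1ℚ ⊡ yₜ) ∙ eyVy∣∅ ∷ [])
         ≐ Σᵉ (𝟙ᵉ ∙ dVy∣x ∷ 𝟙ᵉ ∙ dVy∣t ∷ (- 1ℚ) ⊡ f ∙ dV∅∣x ∷ (- 1ℚ) ⊡ f ∙ dV∅∣t ∷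
              (- 1ℚ) ⊡ (x ⊞ 1ℚ ⊡ yₜ) ∙ eVy∣∅ ∷ []) ⊠ (y ⊟ 1ℚ ⊡ yₜ))
    (D s ((y1 ∷ V) ++ y1 ∷ []) (xL ∷ []) ∷ D s ((y1 ∷ V) ++ y1 ∷ []) (yL t ∷ []) ∷
      D s ((y1 ∷ V) ++ []) (xL ∷ []) ∷ D s ((y1 ∷ V) ++ []) (yL t ∷ []) ∷
      D t ((y1 ∷ V) ++ y1 ∷ []) [] ∷ D s (V ++ y1 ∷ []) (xL ∷ []) ∷
      D s (V ++ y1 ∷ []) (yL t ∷ []) ∷ D s (V ++ []) (xL ∷ []) ∷ D s (V ++ []) (yL t ∷ []) ∷
      D t (V ++ y1 ∷ []) [] ∷ η s y1 ∷ D s (y1 ∷ (V ++ y1 ∷ [])) [] ∷ D s (y1 ∷ (V ++ [])) [] ∷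
      D s (y1 ∷ V) [] ∷ X ∷ Y zero ∷ Y t ∷ [])
    (D-clause s y1 xL (V ++ y1 ∷ []) [] ∷ D-clause s y1 (yL t) (V ++ y1 ∷ []) [] ∷
      D-clause s y1 xL (V ++ []) [] ∷ D-clause s y1 (yL t) (V ++ []) [] ∷
      D-empty-∷ t y1 (V ++ y1 ∷ []) ∷ D-empty-∷ʳ s y1 (y1 ∷ V) ∷ D-++[]₁ s (y1 ∷ V) [] ∷ []) refl
  terms-yzδ-y∷₁ s zero V = solve (λ dyVy∣x dyV∅∣x eyVy∣∅ dVy∣x dV∅∣x eVy∣∅ f dyVy∣∅ dyV∅∣∅ dyV∣∅ x y →
      dyVy∣x ≔ dVy∣x ⊠ y ⊞ dyVy∣∅ ⊠ x ∷
      dyV∅∣x ≔ dV∅∣x ⊠ y ⊞ dyV∅∣∅ ⊠ x ∷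
      eyVy∣∅ ≔ eVy∣∅ ⊠ (y ⊟ 0ℚ ⊡ y) ∷
      dyVy∣∅ ≔ f ⊠ dyV∣∅ ∷
      dyV∅∣∅ ≔ dyV∣∅ ∷
      [] ⊢ Σᵉ (𝟙ᵉ ∙ dyVy∣x ∷ (- 1ℚ) ⊡ f ∙ dyV∅∣x ∷ (- 1ℚ) ⊡ x ∙ eyVy∣∅ ∷ [])
         ≐ Σᵉ (𝟙ᵉ ∙ dVy∣x ∷ (- 1ℚ) ⊡ f ∙ dV∅∣x ∷ (- 1ℚ) ⊡ x ∙ eVy∣∅ ∷ []) ⊠ (y ⊟ 0ℚ ⊡ y))
    (D s ((y1 ∷ V) ++ y1 ∷ []) (xL ∷ []) ∷ D s ((y1 ∷ V) ++ []) (xL ∷ []) ∷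
      D zero ((y1 ∷ V) ++ y1 ∷ []) [] ∷ D s (V ++ y1 ∷ []) (xL ∷ []) ∷ D s (V ++ []) (xL ∷ []) ∷
      D zero (V ++ y1 ∷ []) [] ∷ η s y1 ∷ D s (y1 ∷ (V ++ y1 ∷ [])) [] ∷ D s (y1 ∷ (V ++ [])) [] ∷
      D s (y1 ∷ V) [] ∷ X ∷ Y zero ∷ [])
    (D-clause s y1 xL (V ++ y1 ∷ []) [] ∷ D-clause s y1 xL (V ++ []) [] ∷ D-empty-∷ zero y1 (V ++ y1 ∷ []) ∷
      D-empty-∷ʳ s y1 (y1 ∷ V) ∷ D-++[]₁ s (y1 ∷ V) [] ∷ []) refl

  terms-yzδ-∷₂ : ∀ s t c W → shifted (terms-yzδ s t) [] (c ∷ W) ≋ shifted (terms-yzδ s t) [] W ⊗ letter c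
  terms-yzδ-∷₂ s t@(suc _) c W = solve (λ dy∣cWx dy∣cWt d∅∣cWx d∅∣cWt ey∣cW∅ dy∣Wx dy∣Wt d∅∣Wx d∅∣Wt ey∣W∅
                                          f w∅ w ρc x y yₜ c →
      dy∣cWx ≔ dy∣Wx ⊠ c ⊞ d∅∣Wx ⊠ ρc ∷
      dy∣cWt ≔ dy∣Wt ⊠ c ⊞ d∅∣Wt ⊠ ρc ∷
      d∅∣cWx ≔ d∅∣Wx ⊠ c ∷
      d∅∣cWt ≔ d∅∣Wt ⊠ c ∷
      ey∣cW∅ ≔ ey∣W∅ ⊠ c ⊞ w∅ ⊠ ρc ∷
      d∅∣Wx ≔ x ⊠ w ∷
      d∅∣Wt ≔ yₜ ⊠ w ∷
      w∅ ≔ w ∷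
      [] ⊢ Σᵉ (𝟙ᵉ ∙ dy∣cWx ∷ 𝟙ᵉ ∙ dy∣cWt ∷ (- 1ℚ) ⊡ f ∙ d∅∣cWx ∷ (- 1ℚ) ⊡ f ∙ d∅∣cWt ∷
              (- 1ℚ) ⊡ (x ⊞ 1ℚ ⊡ yₜ) ∙ ey∣cW∅ ∷ [])
         ≐ Σᵉ (𝟙ᵉ ∙ dy∣Wx ∷ 𝟙ᵉ ∙ dy∣Wt ∷ (- 1ℚ) ⊡ f ∙ d∅∣Wx ∷ (- 1ℚ) ⊡ f ∙ d∅∣Wt ∷
              (- 1ℚ) ⊡ (x ⊞ 1ℚ ⊡ yₜ) ∙ ey∣W∅ ∷ []) ⊠ c)
    (D s (y1 ∷ []) ((c ∷ W) ++ xL ∷ []) ∷ D s (y1 ∷ []) ((c ∷ W) ++ yL t ∷ []) ∷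
      D s [] ((c ∷ W) ++ xL ∷ []) ∷ D s [] ((c ∷ W) ++ yL t ∷ []) ∷
      D t (y1 ∷ []) ((c ∷ W) ++ []) ∷ D s (y1 ∷ []) (W ++ xL ∷ []) ∷
      D s (y1 ∷ []) (W ++ yL t ∷ []) ∷ D s [] (W ++ xL ∷ []) ∷ D s [] (W ++ yL t ∷ []) ∷
      D t (y1 ∷ []) (W ++ []) ∷ η s y1 ∷ rword (W ++ []) ∷ rword W ∷ ρ c ∷ X ∷ Y zero ∷ Y t ∷
      letter c ∷ [])
    (D-y-∷ s c (W ++ xL ∷ []) ∷ D-y-∷ s c (W ++ yL t ∷ []) ∷ rword-∷ c (W ++ xL ∷ []) ∷
      rword-∷ c (W ++ yL t ∷ []) ∷ D-y-∷ t c (W ++ []) ∷ rword-∷ʳ xL W ∷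
      rword-∷ʳ (yL t) W ∷ rword-++[] W ∷ []) refl
  terms-yzδ-∷₂ s zero c W = solve (λ dy∣cWx d∅∣cWx ey∣cW∅ dy∣Wx d∅∣Wx ey∣W∅ f w∅ w ρc x y c →
      dy∣cWx ≔ dy∣Wx ⊠ c ⊞ d∅∣Wx ⊠ ρc ∷
      d∅∣cWx ≔ d∅∣Wx ⊠ c ∷
      ey∣cW∅ ≔ ey∣W∅ ⊠ c ⊞ w∅ ⊠ ρc ∷
      d∅∣Wx ≔ x ⊠ w ∷
      w∅ ≔ w ∷
      [] ⊢ Σᵉ (𝟙ᵉ ∙ dy∣cWx ∷ (- 1ℚ) ⊡ f ∙ d∅∣cWx ∷ (- 1ℚ) ⊡ x ∙ ey∣cW∅ ∷ [])
         ≐ Σᵉ (𝟙ᵉ ∙ dy∣Wx ∷ (- 1ℚ) ⊡ f ∙ d∅∣Wx ∷ (- 1ℚ) ⊡ x ∙ ey∣W∅ ∷ []) ⊠ c)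
    (D s (y1 ∷ []) ((c ∷ W) ++ xL ∷ []) ∷ D s [] ((c ∷ W) ++ xL ∷ []) ∷
      D zero (y1 ∷ []) ((c ∷ W) ++ []) ∷ D s (y1 ∷ []) (W ++ xL ∷ []) ∷ D s [] (W ++ xL ∷ []) ∷
      D zero (y1 ∷ []) (W ++ []) ∷ η s y1 ∷ rword (W ++ []) ∷ rword W ∷ ρ c ∷ X ∷ Y zero ∷ letter c ∷ [])
    (D-y-∷ s c (W ++ xL ∷ []) ∷ rword-∷ c (W ++ xL ∷ []) ∷ D-y-∷ zero c (W ++ []) ∷ rword-∷ʳ xL W ∷
      rword-++[] W ∷ []) refl

  terms-yzδ-vanish : ∀ s t V W → shifted (terms-yzδ s t) V W ≋ 𝟘
  terms-yzδ-vanish s t = shifted-vanishes (terms-yzδ s t)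
    (empty₂-vanishes (terms-yzδ s t) t (terms-yzδ-empty s t) (terms-yzδ-y∷₁ s t))
    (empty₁-vanishes (terms-yzδ s t) (terms-yzδ-empty s t) (terms-yzδ-∷₂ s t))

  terms-zz : Fin (suc m) → List Shift
  terms-zz s =
    shift 𝟙 s (x1 ∷ []) (xL ∷ []) ∷ shift 𝟙 s (x1 ∷ []) (yL zero ∷ [])
    ∷ shift 𝟙 s (y1 ∷ []) (xL ∷ []) ∷ shift 𝟙 s (y1 ∷ []) (yL zero ∷ [])
    ∷ shift (sc (- 1ℚ) Z) s [] (xL ∷ []) ∷ shift (sc (- 1ℚ) Z) s [] (yL zero ∷ [])
    ∷ shift (sc (- 1ℚ) Z) s (x1 ∷ []) [] ∷ shift (sc (- 1ℚ) Z) s (y1 ∷ []) []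
    ∷ shift (Z ⊗ Z) s [] [] ∷ []

  terms-zz-empty₁ : ∀ s W → shifted (terms-zz s) [] W ≋ 𝟘
  terms-zz-empty₁ s W = solve (λ dx∣Wx dx∣Wy dy∣Wx dy∣Wy d∅∣Wx d∅∣Wy dx∣W∅ dy∣W∅ d∅∣W∅ w x y →
      dy∣Wx ≔ d∅∣Wx ⊠ (x ⊞ y) ⊟ dx∣Wx ∷
      dy∣Wy ≔ d∅∣Wy ⊠ (x ⊞ y) ⊟ dx∣Wy ∷
      dy∣W∅ ≔ d∅∣W∅ ⊠ (x ⊞ y) ⊟ dx∣W∅ ∷
      d∅∣Wx ≔ x ⊠ w ∷
      d∅∣Wy ≔ y ⊠ w ∷
      d∅∣W∅ ≔ w ∷
      [] ⊢ Σᵉ (𝟙ᵉ ∙ dx∣Wx ∷ 𝟙ᵉ ∙ dx∣Wy ∷ 𝟙ᵉ ∙ dy∣Wx ∷ 𝟙ᵉ ∙ dy∣Wy ∷ (- 1ℚ) ⊡ (x ⊞ y) ∙ d∅∣Wx ∷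
              (- 1ℚ) ⊡ (x ⊞ y) ∙ d∅∣Wy ∷ (- 1ℚ) ⊡ (x ⊞ y) ∙ dx∣W∅ ∷ (- 1ℚ) ⊡ (x ⊞ y) ∙ dy∣W∅ ∷
              (x ⊞ y) ⊠ (x ⊞ y) ∙ d∅∣W∅ ∷ [])
         ≐ 𝟘ᵉ)
    (D s (x1 ∷ []) (W ++ xL ∷ []) ∷ D s (x1 ∷ []) (W ++ yL zero ∷ []) ∷ D s (y1 ∷ []) (W ++ xL ∷ []) ∷
      D s (y1 ∷ []) (W ++ yL zero ∷ []) ∷ D s [] (W ++ xL ∷ []) ∷ D s [] (W ++ yL zero ∷ []) ∷
      D s (x1 ∷ []) (W ++ []) ∷ D s (y1 ∷ []) (W ++ []) ∷ D s [] (W ++ []) ∷ rword W ∷ X ∷ Y zero ∷ [])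
    (D-yˡ s [] (W ++ xL ∷ []) ∷ D-yˡ s [] (W ++ yL zero ∷ []) ∷ D-yˡ s [] (W ++ []) ∷ rword-∷ʳ xL W ∷
      rword-∷ʳ (yL zero) W ∷ rword-++[] W ∷ []) refl

  terms-zz-empty₂ : ∀ s V → shifted (terms-zz s) V [] ≋ 𝟘
  terms-zz-empty₂ s V = solve (λ dVx∣x dVx∣y dVy∣x dVy∣y dV∅∣x dV∅∣y dVx∣∅ dVy∣∅ dV∅∣∅ dV∣∅ δy x y →
      dVx∣y ≔ dVx∣∅ ⊠ (x ⊞ y) ⊟ dVx∣x ∷
      dVy∣y ≔ dVy∣∅ ⊠ (x ⊞ y) ⊟ dVy∣x ∷
      dV∅∣y ≔ dV∅∣∅ ⊠ (x ⊞ y) ⊟ dV∅∣x ∷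
      dVx∣∅ ≔ (x ⊞ δy) ⊠ dV∣∅ ∷
      dVy∣∅ ≔ (y ⊟ δy) ⊠ dV∣∅ ∷
      dV∅∣∅ ≔ dV∣∅ ∷
      [] ⊢ Σᵉ (𝟙ᵉ ∙ dVx∣x ∷ 𝟙ᵉ ∙ dVx∣y ∷ 𝟙ᵉ ∙ dVy∣x ∷ 𝟙ᵉ ∙ dVy∣y ∷ (- 1ℚ) ⊡ (x ⊞ y) ∙ dV∅∣x ∷
              (- 1ℚ) ⊡ (x ⊞ y) ∙ dV∅∣y ∷ (- 1ℚ) ⊡ (x ⊞ y) ∙ dVx∣∅ ∷ (- 1ℚ) ⊡ (x ⊞ y) ∙ dVy∣∅ ∷
              (x ⊞ y) ⊠ (x ⊞ y) ∙ dV∅∣∅ ∷ [])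
         ≐ 𝟘ᵉ)
    (D s (V ++ x1 ∷ []) (xL ∷ []) ∷ D s (V ++ x1 ∷ []) (yL zero ∷ []) ∷ D s (V ++ y1 ∷ []) (xL ∷ []) ∷
      D s (V ++ y1 ∷ []) (yL zero ∷ []) ∷ D s (V ++ []) (xL ∷ []) ∷ D s (V ++ []) (yL zero ∷ []) ∷
      D s (V ++ x1 ∷ []) [] ∷ D s (V ++ y1 ∷ []) [] ∷ D s (V ++ []) [] ∷ D s V [] ∷ sc (δ s) (Y s) ∷ X ∷
      Y zero ∷ [])
    (D-yʳ s (V ++ x1 ∷ []) [] ∷ D-yʳ s (V ++ y1 ∷ []) [] ∷ D-yʳ s (V ++ []) [] ∷ D-empty-∷ʳ s x1 V ∷
      D-empty-∷ʳ s y1 V ∷ D-++[]₁ s V [] ∷ []) refl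

  terms-zz-vanish : ∀ s V W → shifted (terms-zz s) V W ≋ 𝟘
  terms-zz-vanish s = shifted-vanishes (terms-zz s) (terms-zz-empty₂ s) (terms-zz-empty₁ s)

  terms-zzδ : Fin (suc m) → Fin (suc m) → List Shift
  terms-zzδ s zero =
    shift 𝟙 s (x1 ∷ []) (xL ∷ []) ∷ shift 𝟙 s (y1 ∷ []) (xL ∷ [])
    ∷ shift (sc (- 1ℚ) Z) s [] (xL ∷ [])
    ∷ shift (sc (- 1ℚ) X) zero (x1 ∷ []) [] ∷ shift (sc (- 1ℚ) X) zero (y1 ∷ []) []
    ∷ shift (Z ⊗ X) zero [] [] ∷ []
  terms-zzδ s t@(suc _) =
    shift 𝟙 s (x1 ∷ []) (xL ∷ []) ∷ shift 𝟙 s (x1 ∷ []) (yL t ∷ [])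
    ∷ shift 𝟙 s (y1 ∷ []) (xL ∷ []) ∷ shift 𝟙 s (y1 ∷ []) (yL t ∷ [])
    ∷ shift (sc (- 1ℚ) Z) s [] (xL ∷ []) ∷ shift (sc (- 1ℚ) Z) s [] (yL t ∷ [])
    ∷ shift (sc (- 1ℚ) (Zδ t)) t (x1 ∷ []) [] ∷ shift (sc (- 1ℚ) (Zδ t)) t (y1 ∷ []) []
    ∷ shift (Z ⊗ Zδ t) t [] [] ∷ []

  terms-zzδ-empty₁ : ∀ s t W → shifted (terms-zzδ s t) [] W ≋ 𝟘
  terms-zzδ-empty₁ s t@(suc _) W = solve (λ dx∣Wx dx∣Wt dy∣Wx dy∣Wt d∅∣Wx d∅∣Wt ex∣W∅ ey∣W∅ e∅∣W∅ w x y yₜ →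
      dy∣Wx ≔ d∅∣Wx ⊠ (x ⊞ y) ⊟ dx∣Wx ∷
      dy∣Wt ≔ d∅∣Wt ⊠ (x ⊞ y) ⊟ dx∣Wt ∷
      ey∣W∅ ≔ e∅∣W∅ ⊠ (x ⊞ y) ⊟ ex∣W∅ ∷
      d∅∣Wx ≔ x ⊠ w ∷
      d∅∣Wt ≔ yₜ ⊠ w ∷
      e∅∣W∅ ≔ w ∷
      [] ⊢ Σᵉ (𝟙ᵉ ∙ dx∣Wx ∷ 𝟙ᵉ ∙ dx∣Wt ∷ 𝟙ᵉ ∙ dy∣Wx ∷ 𝟙ᵉ ∙ dy∣Wt ∷ (- 1ℚ) ⊡ (x ⊞ y) ∙ d∅∣Wx ∷
              (- 1ℚ) ⊡ (x ⊞ y) ∙ d∅∣Wt ∷ (- 1ℚ) ⊡ (x ⊞ 1ℚ ⊡ yₜ) ∙ ex∣W∅ ∷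
              (- 1ℚ) ⊡ (x ⊞ 1ℚ ⊡ yₜ) ∙ ey∣W∅ ∷ (x ⊞ y) ⊠ (x ⊞ 1ℚ ⊡ yₜ) ∙ e∅∣W∅ ∷ [])
         ≐ 𝟘ᵉ)
    (D s (x1 ∷ []) (W ++ xL ∷ []) ∷ D s (x1 ∷ []) (W ++ yL t ∷ []) ∷
      D s (y1 ∷ []) (W ++ xL ∷ []) ∷ D s (y1 ∷ []) (W ++ yL t ∷ []) ∷ D s [] (W ++ xL ∷ []) ∷
      D s [] (W ++ yL t ∷ []) ∷ D t (x1 ∷ []) (W ++ []) ∷ D t (y1 ∷ []) (W ++ []) ∷
      D t [] (W ++ []) ∷ rword W ∷ X ∷ Y zero ∷ Y t ∷ [])
    (D-yˡ s [] (W ++ xL ∷ []) ∷ D-yˡ s [] (W ++ yL t ∷ []) ∷ D-yˡ t [] (W ++ []) ∷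
      rword-∷ʳ xL W ∷ rword-∷ʳ (yL t) W ∷ rword-++[] W ∷ []) refl
  terms-zzδ-empty₁ s zero W = solve (λ dx∣Wx dy∣Wx d∅∣Wx ex∣W∅ ey∣W∅ e∅∣W∅ w x y →
      dy∣Wx ≔ d∅∣Wx ⊠ (x ⊞ y) ⊟ dx∣Wx ∷
      ey∣W∅ ≔ e∅∣W∅ ⊠ (x ⊞ y) ⊟ ex∣W∅ ∷
      d∅∣Wx ≔ x ⊠ w ∷
      e∅∣W∅ ≔ w ∷
      [] ⊢ Σᵉ (𝟙ᵉ ∙ dx∣Wx ∷ 𝟙ᵉ ∙ dy∣Wx ∷ (- 1ℚ) ⊡ (x ⊞ y) ∙ d∅∣Wx ∷ (- 1ℚ) ⊡ x ∙ ex∣W∅ ∷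
              (- 1ℚ) ⊡ x ∙ ey∣W∅ ∷ (x ⊞ y) ⊠ x ∙ e∅∣W∅ ∷ [])
         ≐ 𝟘ᵉ)
    (D s (x1 ∷ []) (W ++ xL ∷ []) ∷ D s (y1 ∷ []) (W ++ xL ∷ []) ∷ D s [] (W ++ xL ∷ []) ∷
      D zero (x1 ∷ []) (W ++ []) ∷ D zero (y1 ∷ []) (W ++ []) ∷ D zero [] (W ++ []) ∷ rword W ∷ X ∷ Y zero ∷ [])
    (D-yˡ s [] (W ++ xL ∷ []) ∷ D-yˡ zero [] (W ++ []) ∷ rword-∷ʳ xL W ∷ rword-++[] W ∷ []) refl

  terms-zzδ-y∷₁ : ∀ s t V → shifted (terms-zzδ s t) (y1 ∷ V) [] ≋ shifted (terms-zzδ s t) V [] ⊗ η t y1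
  terms-zzδ-y∷₁ s t@(suc _) V = solve (λ dyVx∣x dyVx∣t dyVy∣x dyVy∣t dyV∅∣x dyV∅∣t eyVx∣∅ eyVy∣∅ eyV∅∣∅
                                         dVx∣x dVx∣t dVy∣x dVy∣t dV∅∣x dV∅∣t eVx∣∅ eVy∣∅ eV∅∣∅ dyVx∣∅
                                         dyVy∣∅ dyV∅∣∅ dyV∣∅ δy x y yₜ →
      dyVx∣x ≔ dVx∣x ⊠ y ⊞ dyVx∣∅ ⊠ x ∷
      dyVx∣t ≔ dVx∣t ⊠ y ⊟ (dVx∣x ⊞ dVx∣t) ⊠ yₜ ⊞ dyVx∣∅ ⊠ yₜ ∷
      dyVy∣x ≔ dVy∣x ⊠ y ⊞ dyVy∣∅ ⊠ x ∷
      dyVy∣t ≔ dVy∣t ⊠ y ⊟ (dVy∣x ⊞ dVy∣t) ⊠ yₜ ⊞ dyVy∣∅ ⊠ yₜ ∷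
      dyV∅∣x ≔ dV∅∣x ⊠ y ⊞ dyV∅∣∅ ⊠ x ∷
      dyV∅∣t ≔ dV∅∣t ⊠ y ⊟ (dV∅∣x ⊞ dV∅∣t) ⊠ yₜ ⊞ dyV∅∣∅ ⊠ yₜ ∷
      eyVx∣∅ ≔ eVx∣∅ ⊠ (y ⊟ 1ℚ ⊡ yₜ) ∷
      eyVy∣∅ ≔ eVy∣∅ ⊠ (y ⊟ 1ℚ ⊡ yₜ) ∷
      eyV∅∣∅ ≔ eV∅∣∅ ⊠ (y ⊟ 1ℚ ⊡ yₜ) ∷
      dyVx∣∅ ≔ (x ⊞ δy) ⊠ dyV∣∅ ∷
      dyVy∣∅ ≔ (y ⊟ δy) ⊠ dyV∣∅ ∷
      dyV∅∣∅ ≔ dyV∣∅ ∷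
      [] ⊢ Σᵉ (𝟙ᵉ ∙ dyVx∣x ∷ 𝟙ᵉ ∙ dyVx∣t ∷ 𝟙ᵉ ∙ dyVy∣x ∷ 𝟙ᵉ ∙ dyVy∣t ∷ (- 1ℚ) ⊡ (x ⊞ y) ∙ dyV∅∣x ∷
              (- 1ℚ) ⊡ (x ⊞ y) ∙ dyV∅∣t ∷ (- 1ℚ) ⊡ (x ⊞ 1ℚ ⊡ yₜ) ∙ eyVx∣∅ ∷
              (- 1ℚ) ⊡ (x ⊞ 1ℚ ⊡ yₜ) ∙ eyVy∣∅ ∷ (x ⊞ y) ⊠ (x ⊞ 1ℚ ⊡ yₜ) ∙ eyV∅∣∅ ∷ [])
         ≐ Σᵉ (𝟙ᵉ ∙ dVx∣x ∷ 𝟙ᵉ ∙ dVx∣t ∷ 𝟙ᵉ ∙ dVy∣x ∷ 𝟙ᵉ ∙ dVy∣t ∷ (- 1ℚ) ⊡ (x ⊞ y) ∙ dV∅∣x ∷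
              (- 1ℚ) ⊡ (x ⊞ y) ∙ dV∅∣t ∷ (- 1ℚ) ⊡ (x ⊞ 1ℚ ⊡ yₜ) ∙ eVx∣∅ ∷
              (- 1ℚ) ⊡ (x ⊞ 1ℚ ⊡ yₜ) ∙ eVy∣∅ ∷ (x ⊞ y) ⊠ (x ⊞ 1ℚ ⊡ yₜ) ∙ eV∅∣∅ ∷ []) ⊠ (y ⊟ 1ℚ ⊡ yₜ))
    (D s ((y1 ∷ V) ++ x1 ∷ []) (xL ∷ []) ∷ D s ((y1 ∷ V) ++ x1 ∷ []) (yL t ∷ []) ∷
      D s ((y1 ∷ V) ++ y1 ∷ []) (xL ∷ []) ∷ D s ((y1 ∷ V) ++ y1 ∷ []) (yL t ∷ []) ∷
      D s ((y1 ∷ V) ++ []) (xL ∷ []) ∷ D s ((y1 ∷ V) ++ []) (yL t ∷ []) ∷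
      D t ((y1 ∷ V) ++ x1 ∷ []) [] ∷ D t ((y1 ∷ V) ++ y1 ∷ []) [] ∷
      D t ((y1 ∷ V) ++ []) [] ∷ D s (V ++ x1 ∷ []) (xL ∷ []) ∷
      D s (V ++ x1 ∷ []) (yL t ∷ []) ∷ D s (V ++ y1 ∷ []) (xL ∷ []) ∷
      D s (V ++ y1 ∷ []) (yL t ∷ []) ∷ D s (V ++ []) (xL ∷ []) ∷ D s (V ++ []) (yL t ∷ []) ∷
      D t (V ++ x1 ∷ []) [] ∷ D t (V ++ y1 ∷ []) [] ∷ D t (V ++ []) [] ∷
      D s (y1 ∷ (V ++ x1 ∷ [])) [] ∷ D s (y1 ∷ (V ++ y1 ∷ [])) [] ∷ D s (y1 ∷ (V ++ [])) [] ∷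
      D s (y1 ∷ V) [] ∷ sc (δ s) (Y s) ∷ X ∷ Y zero ∷ Y t ∷ [])
    (D-clause s y1 xL (V ++ x1 ∷ []) [] ∷ D-clause s y1 (yL t) (V ++ x1 ∷ []) [] ∷
      D-clause s y1 xL (V ++ y1 ∷ []) [] ∷ D-clause s y1 (yL t) (V ++ y1 ∷ []) [] ∷
      D-clause s y1 xL (V ++ []) [] ∷ D-clause s y1 (yL t) (V ++ []) [] ∷
      D-empty-∷ t y1 (V ++ x1 ∷ []) ∷ D-empty-∷ t y1 (V ++ y1 ∷ []) ∷
      D-empty-∷ t y1 (V ++ []) ∷ D-empty-∷ʳ s x1 (y1 ∷ V) ∷ D-empty-∷ʳ s y1 (y1 ∷ V) ∷
      D-++[]₁ s (y1 ∷ V) [] ∷ []) refl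
  terms-zzδ-y∷₁ s zero V = solve (λ dyVx∣x dyVy∣x dyV∅∣x eyVx∣∅ eyVy∣∅ eyV∅∣∅ dVx∣x dVy∣x dV∅∣x eVx∣∅ eVy∣∅
                                    eV∅∣∅ dyVx∣∅ dyVy∣∅ dyV∅∣∅ dyV∣∅ δy x y →
      dyVx∣x ≔ dVx∣x ⊠ y ⊞ dyVx∣∅ ⊠ x ∷
      dyVy∣x ≔ dVy∣x ⊠ y ⊞ dyVy∣∅ ⊠ x ∷
      dyV∅∣x ≔ dV∅∣x ⊠ y ⊞ dyV∅∣∅ ⊠ x ∷
      eyVx∣∅ ≔ eVx∣∅ ⊠ (y ⊟ 0ℚ ⊡ y) ∷
      eyVy∣∅ ≔ eVy∣∅ ⊠ (y ⊟ 0ℚ ⊡ y) ∷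
      eyV∅∣∅ ≔ eV∅∣∅ ⊠ (y ⊟ 0ℚ ⊡ y) ∷
      dyVx∣∅ ≔ (x ⊞ δy) ⊠ dyV∣∅ ∷
      dyVy∣∅ ≔ (y ⊟ δy) ⊠ dyV∣∅ ∷
      dyV∅∣∅ ≔ dyV∣∅ ∷
      [] ⊢ Σᵉ (𝟙ᵉ ∙ dyVx∣x ∷ 𝟙ᵉ ∙ dyVy∣x ∷ (- 1ℚ) ⊡ (x ⊞ y) ∙ dyV∅∣x ∷ (- 1ℚ) ⊡ x ∙ eyVx∣∅ ∷
              (- 1ℚ) ⊡ x ∙ eyVy∣∅ ∷ (x ⊞ y) ⊠ x ∙ eyV∅∣∅ ∷ [])
         ≐ Σᵉ (𝟙ᵉ ∙ dVx∣x ∷ 𝟙ᵉ ∙ dVy∣x ∷ (- 1ℚ) ⊡ (x ⊞ y) ∙ dV∅∣x ∷ (- 1ℚ) ⊡ x ∙ eVx∣∅ ∷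
              (- 1ℚ) ⊡ x ∙ eVy∣∅ ∷ (x ⊞ y) ⊠ x ∙ eV∅∣∅ ∷ []) ⊠ (y ⊟ 0ℚ ⊡ y))
    (D s ((y1 ∷ V) ++ x1 ∷ []) (xL ∷ []) ∷ D s ((y1 ∷ V) ++ y1 ∷ []) (xL ∷ []) ∷
      D s ((y1 ∷ V) ++ []) (xL ∷ []) ∷ D zero ((y1 ∷ V) ++ x1 ∷ []) [] ∷
      D zero ((y1 ∷ V) ++ y1 ∷ []) [] ∷ D zero ((y1 ∷ V) ++ []) [] ∷ D s (V ++ x1 ∷ []) (xL ∷ []) ∷
      D s (V ++ y1 ∷ []) (xL ∷ []) ∷ D s (V ++ []) (xL ∷ []) ∷ D zero (V ++ x1 ∷ []) [] ∷
      D zero (V ++ y1 ∷ []) [] ∷ D zero (V ++ []) [] ∷ D s (y1 ∷ (V ++ x1 ∷ [])) [] ∷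
      D s (y1 ∷ (V ++ y1 ∷ [])) [] ∷ D s (y1 ∷ (V ++ [])) [] ∷ D s (y1 ∷ V) [] ∷ sc (δ s) (Y s) ∷ X ∷
      Y zero ∷ [])
    (D-clause s y1 xL (V ++ x1 ∷ []) [] ∷ D-clause s y1 xL (V ++ y1 ∷ []) [] ∷
      D-clause s y1 xL (V ++ []) [] ∷ D-empty-∷ zero y1 (V ++ x1 ∷ []) ∷ D-empty-∷ zero y1 (V ++ y1 ∷ []) ∷
      D-empty-∷ zero y1 (V ++ []) ∷ D-empty-∷ʳ s x1 (y1 ∷ V) ∷ D-empty-∷ʳ s y1 (y1 ∷ V) ∷
      D-++[]₁ s (y1 ∷ V) [] ∷ []) refl

  terms-zzδ-vanish : ∀ s t V W → shifted (terms-zzδ s t) V W ≋ 𝟘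
  terms-zzδ-vanish s t = shifted-vanishes (terms-zzδ s t)
    (empty₂-vanishes (terms-zzδ s t) t (terms-zzδ-empty₁ s t []) (terms-zzδ-y∷₁ s t)) (terms-zzδ-empty₁ s t)


  -- Bilinear extension from words to polynomials

  diaW-D : ∀ (s : Fin (suc m)) v w → diaW s v w ≡ D s (reverse v) (reverse w)
  diaW-D s v w = cong (λ n → dia n s (reverse v) (reverse w))
    (sym (cong₂ _+ℕ_ (List.length-reverse v) (List.length-reverse w)))

  eval-⋄ : ∀ h (s : Fin (suc m)) P Q →
    eval h (P ⋄[ s ] Q) ≡ eval (λ v → eval (λ w → eval h (D s (reverse v) (reverse w))) Q) P
  eval-⋄ h s [] Q = refl
  eval-⋄ h s ((c , v) ∷ P) Q =
    trans (cong (eval h) split) (trans (eval-++ h (((c , v) ∷ []) ⋄[ s ] Q) (P ⋄[ s ] Q))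
      (cong₂ _+_ (monomial Q) (eval-⋄ h s P Q)))
    where
    split : ((c , v) ∷ P) ⋄[ s ] Q ≡ (((c , v) ∷ []) ⋄[ s ] Q) ++ (P ⋄[ s ] Q)
    split = cong (_++ (P ⋄[ s ] Q)) (sym (List.++-identityʳ _))
    monomial : ∀ Q → eval h (((c , v) ∷ []) ⋄[ s ] Q) ≡ c * eval (λ w → eval h (D s (reverse v) (reverse w))) Q
    monomial [] = sym (ℚ.*-zeroʳ c)
    monomial ((d , w) ∷ Q) =
      trans (cong (eval h) (List.++-assoc (sc (c * d) (diaW s v w)) _ []))
        (trans (eval-++ h (sc (c * d) (diaW s v w)) _)
          (trans (cong₂ _+_ (trans (eval-sc h (c * d) (diaW s v w)) (cong (λ R → c * d * eval h R) (diaW-D s v w)))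
                            (monomial Q))
            (*-+-factorˡ c d _ _)))

  -- X is the value at (P, Q) of the bilinear extension of F, F being
  -- applied to the reversals of the words of P and Q
  record Extends (X : Ar m) (F : List L1 → List (Let m) → Ar m) (P : A1) (Q : Ar m) : Set where
    constructor mkExtends
    field eval-extends : ∀ h → eval h X ≡ eval (λ v → eval (λ w → eval h (F (reverse v) (reverse w))) Q) P
  open Extends

  extends-⋄ : ∀ s P Q → Extends (P ⋄[ s ] Q) (D s) P Q
  extends-⋄ s P Q = mkExtends λ h → eval-⋄ h s P Q

  extends-cong : ∀ {X P Q F G} → (∀ V W → F V W ≋ G V W) → Extends X F P Q → Extends X G P Q
  extends-cong {X} {P} {Q} e r = mkExtends λ h →
    trans (eval-extends r h) (eval-cong (λ v → eval-cong (λ w → eval-≡ (e (reverse v) (reverse w)) h) Q) P)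

  extends-unique : ∀ {X X′ P Q F} → Extends X F P Q → Extends X′ F P Q → X ≋ X′
  extends-unique r r′ = mk≋ λ h → trans (eval-extends r h) (sym (eval-extends r′ h))

  extends-⊕ : ∀ {X X′ P Q F G} → Extends X F P Q → Extends X′ G P Q → Extends (X ⊕ X′) (λ V W → F V W ⊕ G V W) P Q
  extends-⊕ {X} {X′} {P} {Q} {F} {G} r r′ = mkExtends λ h →
    trans (eval-++ h X X′) (trans (cong₂ _+_ (eval-extends r h) (eval-extends r′ h))
      (sym (trans (eval-cong (λ v → trans (eval-cong (λ w → eval-++ h (F (reverse v) (reverse w)) _) Q)
                                          (eval-sum _ _ Q)) P)
                  (eval-sum _ _ P))))

  extends-sc : ∀ {X P Q F} c → Extends X F P Q → Extends (sc c X) (λ V W → sc c (F V W)) P Q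
  extends-sc {X} {P} {Q} {F} c r = mkExtends λ h →
    trans (eval-sc h c X) (trans (cong (c *_) (eval-extends r h))
      (sym (trans (eval-cong (λ v → trans (eval-cong (λ w → eval-sc h c (F (reverse v) (reverse w))) Q)
                                          (eval-scale c _ Q)) P)
                  (eval-scale c _ P))))

  extends-⊖ : ∀ {X X′ P Q F G} → Extends X F P Q → Extends X′ G P Q → Extends (X ⊖ X′) (λ V W → F V W ⊖ G V W) P Q
  extends-⊖ r r′ = extends-⊕ r (extends-sc (- 1ℚ) r′)

  extends-⊗ˡ : ∀ {X P Q F} C → Extends X F P Q → Extends (C ⊗ X) (λ V W → C ⊗ F V W) P Q
  extends-⊗ˡ {X} {P} {Q} {F} C r = mkExtends λ h →
    trans (eval-⊗ˡ h C X) (trans (eval-extends r _)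
      (eval-cong (λ v → eval-cong (λ w → sym (eval-⊗ˡ h C (F (reverse v) (reverse w)))) Q) P))

  extends-⊗ʳ : ∀ {X P Q F} C → Extends X F P Q → Extends (X ⊗ C) (λ V W → F V W ⊗ C) P Q
  extends-⊗ʳ {X} {P} {Q} {F} C r = mkExtends λ h →
    trans (eval-⊗ h X C) (trans (eval-extends r _)
      (eval-cong (λ v → eval-cong (λ w → sym (eval-⊗ h (F (reverse v) (reverse w)) C)) Q) P))

  extends-prefix₁ : ∀ {X P Q F} C → Extends X F (C ⊗ P) Q →
                    Extends X (λ V W → lin (λ c → F (V ++ reverse c) W) C) P Q
  extends-prefix₁ {X} {P} {Q} {F} C r = mkExtends λ h →
    trans (eval-extends r h) (trans (eval-⊗ˡ _ C P) (eval-cong (λ p →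
      trans (eval-cong (λ c → eval-cong (λ w → cong (λ V → eval h (F V (reverse w))) (List.reverse-++ c p)) Q) C)
      (trans (eval-swap (λ c w → eval h (F (reverse p ++ reverse c) (reverse w))) C Q)
             (eval-cong (λ w → sym (eval-lin h (λ c → F (reverse p ++ reverse c) (reverse w)) C)) Q))) P))

  extends-suffix₁ : ∀ {X P Q F} C → Extends X F (P ⊗ C) Q →
                    Extends X (λ V W → lin (λ c → F (reverse c ++ V) W) C) P Q
  extends-suffix₁ {X} {P} {Q} {F} C r = mkExtends λ h →
    trans (eval-extends r h) (trans (eval-⊗ _ P C) (eval-cong (λ p →
      trans (eval-cong (λ c → eval-cong (λ w → cong (λ V → eval h (F V (reverse w))) (List.reverse-++ p c)) Q) C)
      (trans (eval-swap (λ c w → eval h (F (reverse c ++ reverse p) (reverse w))) C Q)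
             (eval-cong (λ w → sym (eval-lin h (λ c → F (reverse c ++ reverse p) (reverse w)) C)) Q))) P))

  extends-prefix₂ : ∀ {X P Q F} C → Extends X F P (C ⊗ Q) →
                    Extends X (λ V W → lin (λ c → F V (W ++ reverse c)) C) P Q
  extends-prefix₂ {X} {P} {Q} {F} C r = mkExtends λ h →
    trans (eval-extends r h) (eval-cong (λ v → trans (eval-⊗ˡ _ C Q) (eval-cong (λ q →
      trans (eval-cong (λ c → cong (λ W → eval h (F (reverse v) W)) (List.reverse-++ c q)) C)
            (sym (eval-lin h (λ c → F (reverse v) (reverse q ++ reverse c)) C))) Q)) P)

  extends-suffix₂ : ∀ {X P Q F} C → Extends X F P (Q ⊗ C) →
                    Extends X (λ V W → lin (λ c → F V (reverse c ++ W)) C) P Q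
  extends-suffix₂ {X} {P} {Q} {F} C r = mkExtends λ h →
    trans (eval-extends r h) (eval-cong (λ v → trans (eval-⊗ _ Q C) (eval-cong (λ q →
      trans (eval-cong (λ c → cong (λ W → eval h (F (reverse v) W)) (List.reverse-++ q c)) C)
            (sym (eval-lin h (λ c → F (reverse v) (reverse c ++ reverse q)) C))) Q)) P)

  ⋄-𝟙 : ∀ (s : Fin (suc m)) P → P ⋄[ s ] 𝟙 ≋ lin (mult (η s)) P
  ⋄-𝟙 s P = mk≋ λ h → trans (eval-⋄ h s P 𝟙)
    (trans (eval-cong (λ v → trans (eval-word (λ w → eval h (D s (reverse v) (reverse w))) [])
                                   (eval-≡ (D-reverse v) h)) P)
           (sym (eval-lin h (mult (η s)) P)))
    where
    D-reverse : ∀ v → D s (reverse v) [] ≋ mult (η s) v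
    D-reverse v = ≋-trans (D-empty s (reverse v)) (≋-reflexive (cong (mult (η s)) (List.reverse-involutive v)))

  letter-⋄-𝟙 : ∀ (s : Fin (suc m)) a → letter a ⋄[ s ] 𝟙 ≋ η s a
  letter-⋄-𝟙 s a = ≋-trans (⋄-𝟙 s (letter a)) (≋-trans (lin-word (mult (η s)) (a ∷ [])) (⊗-identityʳ (η s a)))

  ⋄𝟙-⊗ : ∀ (s : Fin (suc m)) P Q → (P ⊗ Q) ⋄[ s ] 𝟙 ≋ (P ⋄[ s ] 𝟙) ⊗ (Q ⋄[ s ] 𝟙)
  ⋄𝟙-⊗ s P Q = ≋-trans (⋄-𝟙 s (P ⊗ Q)) (≋-trans (lin-⊗ (mult (η s)) (mult-++ (η s)) P Q)
    (≋-sym (⊗-cong (⋄-𝟙 s P) (⋄-𝟙 s Q))))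

  τ-++ : ∀ (u v : List (Let m)) → antimult τL (u ++ v) ≋ antimult τL v ⊗ antimult τL u
  τ-++ u v = ≋-trans (≋-reflexive (cong (mult τL) (List.reverse-++ u v))) (mult-++ τL (reverse v) (reverse u))

  τ-mult : ∀ (g : L1 → Ar m) u → τ (mult g u) ≋ mult (λ a → τ (g a)) (reverse u)
  τ-mult g [] = lin-word (antimult τL) []
  τ-mult g (a ∷ u) =
    ≋-trans (lin-⊗-reverse (antimult τL) τ-++ (g a) (mult g u))
    (≋-trans (⊗-cong (τ-mult g u) (≋-sym (⊗-identityʳ (τ (g a)))))
    (≋-trans (≋-sym (mult-++ (λ a → τ (g a)) (reverse u) (a ∷ [])))
      (≋-reflexive (cong (mult (λ a → τ (g a))) (sym (List.unfold-reverse a u))))))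

  τ-η : ∀ (s : Fin (suc m)) a → τ (η s a) ≋ lin (mult (η s)) (τ1L a)
  τ-η zero x1 = solve (λ x y →
    [] ⊢ 1ℚ ⊡ (y ⊠ 𝟙ᵉ) ⊞ (0ℚ ⊡ (x ⊠ 𝟙ᵉ) ⊞ 𝟘ᵉ) ≐ 1ℚ ⊡ ((y ⊟ 0ℚ ⊡ y) ⊠ 𝟙ᵉ) ⊞ 𝟘ᵉ)
    (X ∷ Y zero ∷ []) [] refl
  τ-η zero y1 = solve (λ x y →
    [] ⊢ 1ℚ ⊡ (x ⊠ 𝟙ᵉ) ⊞ (0ℚ ⊡ (x ⊠ 𝟙ᵉ) ⊞ 𝟘ᵉ) ≐ 1ℚ ⊡ ((x ⊞ 0ℚ ⊡ y) ⊠ 𝟙ᵉ) ⊞ 𝟘ᵉ)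
    (X ∷ Y zero ∷ []) [] refl
  τ-η t@(suc _) x1 = solve (λ x y yₜ →
    [] ⊢ 1ℚ ⊡ (y ⊠ 𝟙ᵉ) ⊞ (1ℚ ⊡ ((- 1ℚ) ⊡ yₜ ⊠ 𝟙ᵉ) ⊞ 𝟘ᵉ) ≐ 1ℚ ⊡ ((y ⊟ 1ℚ ⊡ yₜ) ⊠ 𝟙ᵉ) ⊞ 𝟘ᵉ)
    (X ∷ Y zero ∷ Y t ∷ []) [] refl
  τ-η t@(suc _) y1 = solve (λ x y yₜ →
    [] ⊢ 1ℚ ⊡ (x ⊠ 𝟙ᵉ) ⊞ ((- 1ℚ) ⊡ ((- 1ℚ) ⊡ yₜ ⊠ 𝟙ᵉ) ⊞ 𝟘ᵉ) ≐ 1ℚ ⊡ ((x ⊞ 1ℚ ⊡ yₜ) ⊠ 𝟙ᵉ) ⊞ 𝟘ᵉ)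
    (X ∷ Y zero ∷ Y t ∷ []) [] refl

  τ-⋄-𝟙 : ∀ (s : Fin (suc m)) P → τ (P ⋄[ s ] 𝟙) ≋ τ₁ P ⋄[ s ] 𝟙
  τ-⋄-𝟙 s P = ≋-trans (lin-cong (antimult τL) (⋄-𝟙 s P))
    (≋-trans (lin-lin (antimult τL) (mult (η s)) P)
    (≋-trans (lin-ext τ-word P)
      (≋-sym (≋-trans (⋄-𝟙 s (τ₁ P)) (lin-lin (mult (η s)) (antimult τ1L) P)))))
    where
    τ-word : ∀ u → τ (mult (η s) u) ≋ lin (mult (η s)) (antimult τ1L u)
    τ-word u = ≋-trans (τ-mult (η s) u) (≋-trans (mult-cong (τ-η s) (reverse u))
      (≋-sym (lin-mult (mult (η s)) ≋-refl (mult-++ (η s)) τ1L (reverse u))))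

  -- The left-hand sides below spell out lin over the explicit polynomials y₁, z₁,
  -- Z and Zδ t, which is what they reduce to definitionally.

  drop-vanishing : ∀ {P Q R : Ar m} → P ≋ Q ⊕ R → R ≋ 𝟘 → P ≋ Q
  drop-vanishing {P} {Q} {R} e z = ≋-trans e (≋-trans (⊕-cong (≋-refl {P = Q}) z) (≋-reflexive (List.++-identityʳ Q)))

  vy⋄w[z-zδ]ʷ : ∀ (s t : Fin (suc m)) V W →
    lin (λ c → lin (λ c′ → D s (reverse c′ ++ V) (reverse c ++ W)) y₁) (Z ⊖ Zδ t)
    ≋ (lin (λ c → D s (reverse c ++ V) W) y₁ ⊖ lin (λ c → D s V (reverse c ++ W)) (Zδ t)) ⊗ (y₁ ⋄[ t ] 𝟙)
  vy⋄w[z-zδ]ʷ s zero V W = solve (λ dyV∣xW dyV∣yW dyV∣W dV∣xW dV∣yW dxV∣W dV∣W u x y →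
      dyV∣yW ≔ dV∣yW ⊠ y ⊟ dxV∣W ⊠ y ∷
      dV∣yW ≔ dV∣W ⊠ (x ⊞ y) ⊟ dV∣xW ∷
      dxV∣W ≔ dV∣W ⊠ (x ⊞ y) ⊟ dyV∣W ∷
      u ≔ y ⊟ 0ℚ ⊡ y ∷
      [] ⊢ 1ℚ ⊡ (1ℚ ⊡ dyV∣xW ⊞ 𝟘ᵉ) ⊞ (1ℚ ⊡ (1ℚ ⊡ dyV∣yW ⊞ 𝟘ᵉ) ⊞ ((- 1ℚ) ⊡ (1ℚ ⊡ dyV∣xW ⊞ 𝟘ᵉ)
           ⊞ (0ℚ ⊡ (1ℚ ⊡ dyV∣yW ⊞ 𝟘ᵉ) ⊞ 𝟘ᵉ)))
         ≐ (1ℚ ⊡ dyV∣W ⊞ 𝟘ᵉ ⊟ (1ℚ ⊡ dV∣xW ⊞ (0ℚ ⊡ dV∣yW ⊞ 𝟘ᵉ))) ⊠ u)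
    (D s (y1 ∷ V) (xL ∷ W) ∷ D s (y1 ∷ V) (yL zero ∷ W) ∷ D s (y1 ∷ V) W ∷ D s V (xL ∷ W)
      ∷ D s V (yL zero ∷ W) ∷ D s (x1 ∷ V) W ∷ D s V W ∷ (y₁ ⋄[ zero ] 𝟙) ∷ X ∷ Y zero ∷ [])
    (D-clause s y1 (yL zero) V W ∷ D-yʳ s V W ∷ D-xˡ s V W ∷ letter-⋄-𝟙 zero y1 ∷ []) refl
  vy⋄w[z-zδ]ʷ s t@(suc _) V W = solve (λ dyV∣xW dyV∣yW dyV∣tW dyV∣W dV∣xW dV∣yW dV∣tW dxV∣W dV∣W u x y yₜ →
      dyV∣yW ≔ dV∣yW ⊠ y ⊟ dxV∣W ⊠ y ∷
      dyV∣tW ≔ dV∣tW ⊠ y ⊟ (dV∣xW ⊞ dV∣tW) ⊠ yₜ ⊞ dyV∣W ⊠ yₜ ∷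
      dV∣yW ≔ dV∣W ⊠ (x ⊞ y) ⊟ dV∣xW ∷
      dxV∣W ≔ dV∣W ⊠ (x ⊞ y) ⊟ dyV∣W ∷
      u ≔ y ⊟ 1ℚ ⊡ yₜ ∷
      [] ⊢ 1ℚ ⊡ (1ℚ ⊡ dyV∣xW ⊞ 𝟘ᵉ) ⊞ (1ℚ ⊡ (1ℚ ⊡ dyV∣yW ⊞ 𝟘ᵉ) ⊞ ((- 1ℚ) ⊡ (1ℚ ⊡ dyV∣xW ⊞ 𝟘ᵉ)
           ⊞ ((- 1ℚ) ⊡ (1ℚ ⊡ dyV∣tW ⊞ 𝟘ᵉ) ⊞ 𝟘ᵉ)))
         ≐ (1ℚ ⊡ dyV∣W ⊞ 𝟘ᵉ ⊟ (1ℚ ⊡ dV∣xW ⊞ (1ℚ ⊡ dV∣tW ⊞ 𝟘ᵉ))) ⊠ u)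
    (D s (y1 ∷ V) (xL ∷ W) ∷ D s (y1 ∷ V) (yL zero ∷ W) ∷ D s (y1 ∷ V) (yL t ∷ W) ∷ D s (y1 ∷ V) W
      ∷ D s V (xL ∷ W) ∷ D s V (yL zero ∷ W) ∷ D s V (yL t ∷ W) ∷ D s (x1 ∷ V) W ∷ D s V W
      ∷ (y₁ ⋄[ t ] 𝟙) ∷ X ∷ Y zero ∷ Y t ∷ [])
    (D-clause s y1 (yL zero) V W ∷ D-clause s y1 (yL t) V W ∷ D-yʳ s V W ∷ D-xˡ s V W ∷ letter-⋄-𝟙 t y1 ∷ [])
    refl

  yv⋄zwʷ : ∀ (s : Fin (suc m)) V W →
    lin (λ c → lin (λ c′ → D s (V ++ reverse c′) (W ++ reverse c)) y₁) Z
    ≋ (y₁ ⋄[ s ] 𝟙) ⊗ lin (λ c → D s V (W ++ reverse c)) Z ⊕ Z ⊗ lin (λ c → D s (V ++ reverse c) W) y₁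
      ⊖ (Z ⊗ (y₁ ⋄[ s ] 𝟙)) ⊗ D s V W
  yv⋄zwʷ s V W = drop-vanishing (solve (λ dVy∣Wx dVy∣Wy dV∅∣Wx dV∅∣Wy dVy∣W∅ dV∅∣W∅ dV∣Wx dV∣Wy dVy∣W dV∣W
                                          u f x y →
      u ≔ f ∷
      dV∅∣Wx ≔ dV∣Wx ∷
      dV∅∣Wy ≔ dV∣Wy ∷
      dVy∣W∅ ≔ dVy∣W ∷
      dV∅∣W∅ ≔ dV∣W ∷
      [] ⊢ 1ℚ ⊡ (1ℚ ⊡ dVy∣Wx ⊞ 𝟘ᵉ) ⊞ (1ℚ ⊡ (1ℚ ⊡ dVy∣Wy ⊞ 𝟘ᵉ) ⊞ 𝟘ᵉ)
         ≐ u ⊠ (1ℚ ⊡ dV∣Wx ⊞ (1ℚ ⊡ dV∣Wy ⊞ 𝟘ᵉ)) ⊞ (x ⊞ y) ⊠ (1ℚ ⊡ dVy∣W ⊞ 𝟘ᵉ) ⊟ (x ⊞ y) ⊠ u ⊠ dV∣W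
           ⊞ Σᵉ (𝟙ᵉ ∙ dVy∣Wx ∷ 𝟙ᵉ ∙ dVy∣Wy ∷ (- 1ℚ) ⊡ f ∙ dV∅∣Wx ∷ (- 1ℚ) ⊡ f ∙ dV∅∣Wy
                 ∷ (- 1ℚ) ⊡ (x ⊞ y) ∙ dVy∣W∅ ∷ (x ⊞ y) ⊠ f ∙ dV∅∣W∅ ∷ []))
    (D s (V ++ y1 ∷ []) (W ++ xL ∷ []) ∷ D s (V ++ y1 ∷ []) (W ++ yL zero ∷ []) ∷ D s (V ++ []) (W ++ xL ∷ [])
      ∷ D s (V ++ []) (W ++ yL zero ∷ []) ∷ D s (V ++ y1 ∷ []) (W ++ []) ∷ D s (V ++ []) (W ++ [])
      ∷ D s V (W ++ xL ∷ []) ∷ D s V (W ++ yL zero ∷ []) ∷ D s (V ++ y1 ∷ []) W ∷ D s V W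
      ∷ (y₁ ⋄[ s ] 𝟙) ∷ η s y1 ∷ X ∷ Y zero ∷ [])
    (letter-⋄-𝟙 s y1 ∷ D-++[]₁ s V (W ++ xL ∷ []) ∷ D-++[]₁ s V (W ++ yL zero ∷ []) ∷ D-++[]₂ s (V ++ y1 ∷ []) W
      ∷ ≋-trans (D-++[]₁ s V (W ++ [])) (D-++[]₂ s V W) ∷ []) refl)
    (terms-yz-vanish s V W)

  yv⋄zδwʷ : ∀ (s t : Fin (suc m)) V W →
    lin (λ c → lin (λ c′ → D s (V ++ reverse c′) (W ++ reverse c)) y₁) (Zδ t)
    ≋ (y₁ ⋄[ s ] 𝟙) ⊗ lin (λ c → D s V (W ++ reverse c)) (Zδ t) ⊕ Zδ t ⊗ lin (λ c → D t (V ++ reverse c) W) y₁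
  yv⋄zδwʷ s zero V W = drop-vanishing (solve (λ dVy∣Wx dVy∣Wy dV∅∣Wx eVy∣W∅ dV∣Wx dV∣Wy eVy∣W u f x y →
      u ≔ f ∷
      dV∅∣Wx ≔ dV∣Wx ∷
      eVy∣W∅ ≔ eVy∣W ∷
      [] ⊢ 1ℚ ⊡ (1ℚ ⊡ dVy∣Wx ⊞ 𝟘ᵉ) ⊞ (0ℚ ⊡ (1ℚ ⊡ dVy∣Wy ⊞ 𝟘ᵉ) ⊞ 𝟘ᵉ)
         ≐ u ⊠ (1ℚ ⊡ dV∣Wx ⊞ (0ℚ ⊡ dV∣Wy ⊞ 𝟘ᵉ)) ⊞ (x ⊞ 0ℚ ⊡ y) ⊠ (1ℚ ⊡ eVy∣W ⊞ 𝟘ᵉ)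
           ⊞ Σᵉ (𝟙ᵉ ∙ dVy∣Wx ∷ (- 1ℚ) ⊡ f ∙ dV∅∣Wx ∷ (- 1ℚ) ⊡ x ∙ eVy∣W∅ ∷ []))
    (D s (V ++ y1 ∷ []) (W ++ xL ∷ []) ∷ D s (V ++ y1 ∷ []) (W ++ yL zero ∷ []) ∷ D s (V ++ []) (W ++ xL ∷ [])
      ∷ D zero (V ++ y1 ∷ []) (W ++ []) ∷ D s V (W ++ xL ∷ []) ∷ D s V (W ++ yL zero ∷ []) ∷ D zero (V ++ y1 ∷ []) W
      ∷ (y₁ ⋄[ s ] 𝟙) ∷ η s y1 ∷ X ∷ Y zero ∷ [])
    (letter-⋄-𝟙 s y1 ∷ D-++[]₁ s V (W ++ xL ∷ []) ∷ D-++[]₂ zero (V ++ y1 ∷ []) W ∷ []) refl)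
    (terms-yzδ-vanish s zero V W)
  yv⋄zδwʷ s t@(suc _) V W = drop-vanishing (solve (λ dVy∣Wx dVy∣Wt dV∅∣Wx dV∅∣Wt eVy∣W∅ dV∣Wx dV∣Wt eVy∣W u
                                                     f x yₜ →
      u ≔ f ∷
      dV∅∣Wx ≔ dV∣Wx ∷
      dV∅∣Wt ≔ dV∣Wt ∷
      eVy∣W∅ ≔ eVy∣W ∷
      [] ⊢ 1ℚ ⊡ (1ℚ ⊡ dVy∣Wx ⊞ 𝟘ᵉ) ⊞ (1ℚ ⊡ (1ℚ ⊡ dVy∣Wt ⊞ 𝟘ᵉ) ⊞ 𝟘ᵉ)
         ≐ u ⊠ (1ℚ ⊡ dV∣Wx ⊞ (1ℚ ⊡ dV∣Wt ⊞ 𝟘ᵉ)) ⊞ (x ⊞ 1ℚ ⊡ yₜ) ⊠ (1ℚ ⊡ eVy∣W ⊞ 𝟘ᵉ)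
           ⊞ Σᵉ (𝟙ᵉ ∙ dVy∣Wx ∷ 𝟙ᵉ ∙ dVy∣Wt ∷ (- 1ℚ) ⊡ f ∙ dV∅∣Wx ∷ (- 1ℚ) ⊡ f ∙ dV∅∣Wt
                 ∷ (- 1ℚ) ⊡ (x ⊞ 1ℚ ⊡ yₜ) ∙ eVy∣W∅ ∷ []))
    (D s (V ++ y1 ∷ []) (W ++ xL ∷ []) ∷ D s (V ++ y1 ∷ []) (W ++ yL t ∷ []) ∷ D s (V ++ []) (W ++ xL ∷ [])
      ∷ D s (V ++ []) (W ++ yL t ∷ []) ∷ D t (V ++ y1 ∷ []) (W ++ []) ∷ D s V (W ++ xL ∷ []) ∷ D s V (W ++ yL t ∷ [])
      ∷ D t (V ++ y1 ∷ []) W ∷ (y₁ ⋄[ s ] 𝟙) ∷ η s y1 ∷ X ∷ Y t ∷ [])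
    (letter-⋄-𝟙 s y1 ∷ D-++[]₁ s V (W ++ xL ∷ []) ∷ D-++[]₁ s V (W ++ yL t ∷ []) ∷ D-++[]₂ t (V ++ y1 ∷ []) W ∷ [])
    refl)
    (terms-yzδ-vanish s t V W)

  zv⋄zwʷ : ∀ (s : Fin (suc m)) V W →
    lin (λ c → lin (λ c′ → D s (V ++ reverse c′) (W ++ reverse c)) z₁) Z
    ≋ Z ⊗ (lin (λ c → D s V (W ++ reverse c)) Z ⊕ lin (λ c → D s (V ++ reverse c) W) z₁ ⊖ Z ⊗ D s V W)
  zv⋄zwʷ s V W = drop-vanishing (solve (λ dVx∣Wx dVx∣Wy dVy∣Wx dVy∣Wy dV∅∣Wx dV∅∣Wy dVx∣W∅ dVy∣W∅ dV∅∣W∅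
                                         dV∣Wx dV∣Wy dVx∣W dVy∣W dV∣W x y →
      dV∅∣Wx ≔ dV∣Wx ∷
      dV∅∣Wy ≔ dV∣Wy ∷
      dVx∣W∅ ≔ dVx∣W ∷
      dVy∣W∅ ≔ dVy∣W ∷
      dV∅∣W∅ ≔ dV∣W ∷
      [] ⊢ 1ℚ ⊡ (1ℚ ⊡ dVx∣Wx ⊞ (1ℚ ⊡ dVy∣Wx ⊞ 𝟘ᵉ)) ⊞ (1ℚ ⊡ (1ℚ ⊡ dVx∣Wy ⊞ (1ℚ ⊡ dVy∣Wy ⊞ 𝟘ᵉ)) ⊞ 𝟘ᵉ)
         ≐ (x ⊞ y) ⊠ ((1ℚ ⊡ dV∣Wx ⊞ (1ℚ ⊡ dV∣Wy ⊞ 𝟘ᵉ)) ⊞ (1ℚ ⊡ dVx∣W ⊞ (1ℚ ⊡ dVy∣W ⊞ 𝟘ᵉ)) ⊟ (x ⊞ y) ⊠ dV∣W)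
           ⊞ Σᵉ (𝟙ᵉ ∙ dVx∣Wx ∷ 𝟙ᵉ ∙ dVx∣Wy ∷ 𝟙ᵉ ∙ dVy∣Wx ∷ 𝟙ᵉ ∙ dVy∣Wy
                 ∷ (- 1ℚ) ⊡ (x ⊞ y) ∙ dV∅∣Wx ∷ (- 1ℚ) ⊡ (x ⊞ y) ∙ dV∅∣Wy
                 ∷ (- 1ℚ) ⊡ (x ⊞ y) ∙ dVx∣W∅ ∷ (- 1ℚ) ⊡ (x ⊞ y) ∙ dVy∣W∅ ∷ (x ⊞ y) ⊠ (x ⊞ y) ∙ dV∅∣W∅ ∷ []))
    (D s (V ++ x1 ∷ []) (W ++ xL ∷ []) ∷ D s (V ++ x1 ∷ []) (W ++ yL zero ∷ []) ∷ D s (V ++ y1 ∷ []) (W ++ xL ∷ [])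
      ∷ D s (V ++ y1 ∷ []) (W ++ yL zero ∷ []) ∷ D s (V ++ []) (W ++ xL ∷ []) ∷ D s (V ++ []) (W ++ yL zero ∷ [])
      ∷ D s (V ++ x1 ∷ []) (W ++ []) ∷ D s (V ++ y1 ∷ []) (W ++ []) ∷ D s (V ++ []) (W ++ [])
      ∷ D s V (W ++ xL ∷ []) ∷ D s V (W ++ yL zero ∷ []) ∷ D s (V ++ x1 ∷ []) W ∷ D s (V ++ y1 ∷ []) W ∷ D s V W
      ∷ X ∷ Y zero ∷ [])
    (D-++[]₁ s V (W ++ xL ∷ []) ∷ D-++[]₁ s V (W ++ yL zero ∷ []) ∷ D-++[]₂ s (V ++ x1 ∷ []) W
      ∷ D-++[]₂ s (V ++ y1 ∷ []) W ∷ ≋-trans (D-++[]₁ s V (W ++ [])) (D-++[]₂ s V W) ∷ []) refl)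
    (terms-zz-vanish s V W)

  zv⋄zδwʷ : ∀ (s t : Fin (suc m)) V W →
    lin (λ c → lin (λ c′ → D s (V ++ reverse c′) (W ++ reverse c)) z₁) (Zδ t)
    ≋ Z ⊗ lin (λ c → D s V (W ++ reverse c)) (Zδ t) ⊕ Zδ t ⊗ lin (λ c → D t (V ++ reverse c) W) z₁
      ⊖ (Z ⊗ Zδ t) ⊗ D t V W
  zv⋄zδwʷ s zero V W = drop-vanishing (solve (λ dVx∣Wx dVx∣Wy dVy∣Wx dVy∣Wy dV∅∣Wx eVx∣W∅ eVy∣W∅ eV∅∣W∅
                                               dV∣Wx dV∣Wy eVx∣W eVy∣W eV∣W x y →
      dV∅∣Wx ≔ dV∣Wx ∷
      eVx∣W∅ ≔ eVx∣W ∷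
      eVy∣W∅ ≔ eVy∣W ∷
      eV∅∣W∅ ≔ eV∣W ∷
      [] ⊢ 1ℚ ⊡ (1ℚ ⊡ dVx∣Wx ⊞ (1ℚ ⊡ dVy∣Wx ⊞ 𝟘ᵉ)) ⊞ (0ℚ ⊡ (1ℚ ⊡ dVx∣Wy ⊞ (1ℚ ⊡ dVy∣Wy ⊞ 𝟘ᵉ)) ⊞ 𝟘ᵉ)
         ≐ (x ⊞ y) ⊠ (1ℚ ⊡ dV∣Wx ⊞ (0ℚ ⊡ dV∣Wy ⊞ 𝟘ᵉ)) ⊞ (x ⊞ 0ℚ ⊡ y) ⊠ (1ℚ ⊡ eVx∣W ⊞ (1ℚ ⊡ eVy∣W ⊞ 𝟘ᵉ))
           ⊟ (x ⊞ y) ⊠ (x ⊞ 0ℚ ⊡ y) ⊠ eV∣W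
           ⊞ Σᵉ (𝟙ᵉ ∙ dVx∣Wx ∷ 𝟙ᵉ ∙ dVy∣Wx ∷ (- 1ℚ) ⊡ (x ⊞ y) ∙ dV∅∣Wx
                 ∷ (- 1ℚ) ⊡ x ∙ eVx∣W∅ ∷ (- 1ℚ) ⊡ x ∙ eVy∣W∅ ∷ (x ⊞ y) ⊠ x ∙ eV∅∣W∅ ∷ []))
    (D s (V ++ x1 ∷ []) (W ++ xL ∷ []) ∷ D s (V ++ x1 ∷ []) (W ++ yL zero ∷ []) ∷ D s (V ++ y1 ∷ []) (W ++ xL ∷ [])
      ∷ D s (V ++ y1 ∷ []) (W ++ yL zero ∷ []) ∷ D s (V ++ []) (W ++ xL ∷ [])
      ∷ D zero (V ++ x1 ∷ []) (W ++ []) ∷ D zero (V ++ y1 ∷ []) (W ++ []) ∷ D zero (V ++ []) (W ++ [])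
      ∷ D s V (W ++ xL ∷ []) ∷ D s V (W ++ yL zero ∷ []) ∷ D zero (V ++ x1 ∷ []) W ∷ D zero (V ++ y1 ∷ []) W
      ∷ D zero V W ∷ X ∷ Y zero ∷ [])
    (D-++[]₁ s V (W ++ xL ∷ []) ∷ D-++[]₂ zero (V ++ x1 ∷ []) W ∷ D-++[]₂ zero (V ++ y1 ∷ []) W
      ∷ ≋-trans (D-++[]₁ zero V (W ++ [])) (D-++[]₂ zero V W) ∷ []) refl)
    (terms-zzδ-vanish s zero V W)
  zv⋄zδwʷ s t@(suc _) V W = drop-vanishing (solve (λ dVx∣Wx dVx∣Wt dVy∣Wx dVy∣Wt dV∅∣Wx dV∅∣Wt eVx∣W∅ eVy∣W∅ eV∅∣W∅
                                                   dV∣Wx dV∣Wt eVx∣W eVy∣W eV∣W x y yₜ →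
      dV∅∣Wx ≔ dV∣Wx ∷
      dV∅∣Wt ≔ dV∣Wt ∷
      eVx∣W∅ ≔ eVx∣W ∷
      eVy∣W∅ ≔ eVy∣W ∷
      eV∅∣W∅ ≔ eV∣W ∷
      [] ⊢ 1ℚ ⊡ (1ℚ ⊡ dVx∣Wx ⊞ (1ℚ ⊡ dVy∣Wx ⊞ 𝟘ᵉ)) ⊞ (1ℚ ⊡ (1ℚ ⊡ dVx∣Wt ⊞ (1ℚ ⊡ dVy∣Wt ⊞ 𝟘ᵉ)) ⊞ 𝟘ᵉ)
         ≐ (x ⊞ y) ⊠ (1ℚ ⊡ dV∣Wx ⊞ (1ℚ ⊡ dV∣Wt ⊞ 𝟘ᵉ)) ⊞ (x ⊞ 1ℚ ⊡ yₜ) ⊠ (1ℚ ⊡ eVx∣W ⊞ (1ℚ ⊡ eVy∣W ⊞ 𝟘ᵉ))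
           ⊟ (x ⊞ y) ⊠ (x ⊞ 1ℚ ⊡ yₜ) ⊠ eV∣W
           ⊞ Σᵉ (𝟙ᵉ ∙ dVx∣Wx ∷ 𝟙ᵉ ∙ dVx∣Wt ∷ 𝟙ᵉ ∙ dVy∣Wx ∷ 𝟙ᵉ ∙ dVy∣Wt
                 ∷ (- 1ℚ) ⊡ (x ⊞ y) ∙ dV∅∣Wx ∷ (- 1ℚ) ⊡ (x ⊞ y) ∙ dV∅∣Wt
                 ∷ (- 1ℚ) ⊡ (x ⊞ 1ℚ ⊡ yₜ) ∙ eVx∣W∅ ∷ (- 1ℚ) ⊡ (x ⊞ 1ℚ ⊡ yₜ) ∙ eVy∣W∅
                 ∷ (x ⊞ y) ⊠ (x ⊞ 1ℚ ⊡ yₜ) ∙ eV∅∣W∅ ∷ []))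
    (D s (V ++ x1 ∷ []) (W ++ xL ∷ []) ∷ D s (V ++ x1 ∷ []) (W ++ yL t ∷ []) ∷ D s (V ++ y1 ∷ []) (W ++ xL ∷ [])
      ∷ D s (V ++ y1 ∷ []) (W ++ yL t ∷ []) ∷ D s (V ++ []) (W ++ xL ∷ []) ∷ D s (V ++ []) (W ++ yL t ∷ [])
      ∷ D t (V ++ x1 ∷ []) (W ++ []) ∷ D t (V ++ y1 ∷ []) (W ++ []) ∷ D t (V ++ []) (W ++ [])
      ∷ D s V (W ++ xL ∷ []) ∷ D s V (W ++ yL t ∷ []) ∷ D t (V ++ x1 ∷ []) W ∷ D t (V ++ y1 ∷ []) W
      ∷ D t V W ∷ X ∷ Y zero ∷ Y t ∷ [])
    (D-++[]₁ s V (W ++ xL ∷ []) ∷ D-++[]₁ s V (W ++ yL t ∷ []) ∷ D-++[]₂ t (V ++ x1 ∷ []) W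
      ∷ D-++[]₂ t (V ++ y1 ∷ []) W ∷ ≋-trans (D-++[]₁ t V (W ++ [])) (D-++[]₂ t V W) ∷ []) refl)
    (terms-zzδ-vanish s t V W)

  vy⋄w[z-zδ] : ∀ (s t : Fin (suc m)) v w →
    (v ⊗ y₁) ⋄[ s ] (w ⊗ (Z ⊖ Zδ t)) ≋ (((v ⊗ y₁) ⋄[ s ] w) ⊖ (v ⋄[ s ] (w ⊗ Zδ t))) ⊗ (y₁ ⋄[ t ] 𝟙)
  vy⋄w[z-zδ] s t v w = extends-unique
    (extends-cong (vy⋄w[z-zδ]ʷ s t)
      (extends-suffix₂ (Z ⊖ Zδ t) (extends-suffix₁ y₁ (extends-⋄ s (v ⊗ y₁) (w ⊗ (Z ⊖ Zδ t))))))
    (extends-⊗ʳ (y₁ ⋄[ t ] 𝟙)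
      (extends-⊖ (extends-suffix₁ y₁ (extends-⋄ s (v ⊗ y₁) w)) (extends-suffix₂ (Zδ t) (extends-⋄ s v (w ⊗ Zδ t)))))

  yv⋄zw : ∀ (s : Fin (suc m)) v w → (y₁ ⊗ v) ⋄[ s ] (Z ⊗ w)
    ≋ (y₁ ⋄[ s ] 𝟙) ⊗ (v ⋄[ s ] (Z ⊗ w)) ⊕ Z ⊗ ((y₁ ⊗ v) ⋄[ s ] w) ⊖ Z ⊗ (y₁ ⋄[ s ] 𝟙) ⊗ (v ⋄[ s ] w)
  yv⋄zw s v w = extends-unique
    (extends-cong (yv⋄zwʷ s) (extends-prefix₂ Z (extends-prefix₁ y₁ (extends-⋄ s (y₁ ⊗ v) (Z ⊗ w)))))
    (extends-⊖ (extends-⊕ (extends-⊗ˡ (y₁ ⋄[ s ] 𝟙) (extends-prefix₂ Z (extends-⋄ s v (Z ⊗ w))))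
                          (extends-⊗ˡ Z (extends-prefix₁ y₁ (extends-⋄ s (y₁ ⊗ v) w))))
               (extends-⊗ˡ (Z ⊗ (y₁ ⋄[ s ] 𝟙)) (extends-⋄ s v w)))

  yv⋄zδw : ∀ (s t : Fin (suc m)) v w → (y₁ ⊗ v) ⋄[ s ] (Zδ t ⊗ w)
    ≋ (y₁ ⋄[ s ] 𝟙) ⊗ (v ⋄[ s ] (Zδ t ⊗ w)) ⊕ Zδ t ⊗ ((y₁ ⊗ v) ⋄[ t ] w)
  yv⋄zδw s t v w = extends-unique
    (extends-cong (yv⋄zδwʷ s t) (extends-prefix₂ (Zδ t) (extends-prefix₁ y₁ (extends-⋄ s (y₁ ⊗ v) (Zδ t ⊗ w)))))
    (extends-⊕ (extends-⊗ˡ (y₁ ⋄[ s ] 𝟙) (extends-prefix₂ (Zδ t) (extends-⋄ s v (Zδ t ⊗ w))))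
               (extends-⊗ˡ (Zδ t) (extends-prefix₁ y₁ (extends-⋄ t (y₁ ⊗ v) w))))

  zv⋄zw : ∀ (s : Fin (suc m)) v w → (z₁ ⊗ v) ⋄[ s ] (Z ⊗ w)
    ≋ Z ⊗ ((v ⋄[ s ] (Z ⊗ w)) ⊕ ((z₁ ⊗ v) ⋄[ s ] w) ⊖ Z ⊗ (v ⋄[ s ] w))
  zv⋄zw s v w = extends-unique
    (extends-cong (zv⋄zwʷ s) (extends-prefix₂ Z (extends-prefix₁ z₁ (extends-⋄ s (z₁ ⊗ v) (Z ⊗ w)))))
    (extends-⊗ˡ Z (extends-⊖ (extends-⊕ (extends-prefix₂ Z (extends-⋄ s v (Z ⊗ w)))
                                        (extends-prefix₁ z₁ (extends-⋄ s (z₁ ⊗ v) w)))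
                             (extends-⊗ˡ Z (extends-⋄ s v w))))

  zv⋄zδw : ∀ (s t : Fin (suc m)) v w → (z₁ ⊗ v) ⋄[ s ] (Zδ t ⊗ w)
    ≋ Z ⊗ (v ⋄[ s ] (Zδ t ⊗ w)) ⊕ Zδ t ⊗ ((z₁ ⊗ v) ⋄[ t ] w) ⊖ Z ⊗ Zδ t ⊗ (v ⋄[ t ] w)
  zv⋄zδw s t v w = extends-unique
    (extends-cong (zv⋄zδwʷ s t) (extends-prefix₂ (Zδ t) (extends-prefix₁ z₁ (extends-⋄ s (z₁ ⊗ v) (Zδ t ⊗ w)))))
    (extends-⊖ (extends-⊕ (extends-⊗ˡ Z (extends-prefix₂ (Zδ t) (extends-⋄ s v (Zδ t ⊗ w))))
                          (extends-⊗ˡ (Zδ t) (extends-prefix₁ z₁ (extends-⋄ t (z₁ ⊗ v) w))))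
               (extends-⊗ˡ (Z ⊗ Zδ t) (extends-⋄ t v w)))

  coeff-eval : ∀ (P : Ar m) w → coeff _≟L_ P w ≡ eval (λ u → if does (List.≡-dec _≟L_ u w) then 1ℚ else 0ℚ) P
  coeff-eval [] w = refl
  coeff-eval ((c , u) ∷ P) w with List.≡-dec _≟L_ u w
  ... | yes _ = trans (cong (c +_) (coeff-eval P w)) (cong (_+ _) (sym (ℚ.*-identityʳ c)))
  ... | no _ = trans (coeff-eval P w) (sym (trans (cong (_+ _) (ℚ.*-zeroʳ c)) (ℚ.+-identityˡ _)))

  ≋⇒≈ : ∀ {P Q : Ar m} → P ≋ Q → P ≈ Q
  ≋⇒≈ {P} {Q} e w = trans (coeff-eval P w) (trans (eval-≡ e _) (sym (coeff-eval Q w)))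

lemma5p9 : (m : ℕ) (s t : Fin (suc m)) (v v' : A1) (w : Ar m) →
    ((v ⊗ v') ⋄[ s ] 𝟙 ≈ (v ⋄[ s ] 𝟙) ⊗ (v' ⋄[ s ] 𝟙))
    × ((v ⊗ y₁) ⋄[ s ] (w ⊗ (Z ⊖ Zδ t))
    ≈ (((v ⊗ y₁) ⋄[ s ] w) ⊖ (v ⋄[ s ] (w ⊗ Zδ t))) ⊗ (y₁ ⋄[ t ] 𝟙))
    × ((y₁ ⊗ v) ⋄[ s ] (Z ⊗ w)
    ≈ (y₁ ⋄[ s ] 𝟙) ⊗ (v ⋄[ s ] (Z ⊗ w)) ⊕ Z ⊗ ((y₁ ⊗ v) ⋄[ s ] w)
    ⊖ Z ⊗ (y₁ ⋄[ s ] 𝟙) ⊗ (v ⋄[ s ] w))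
    × ((y₁ ⊗ v) ⋄[ s ] (Zδ t ⊗ w)
    ≈ (y₁ ⋄[ s ] 𝟙) ⊗ (v ⋄[ s ] (Zδ t ⊗ w)) ⊕ Zδ t ⊗ ((y₁ ⊗ v) ⋄[ t ] w))
    × ((z₁ ⊗ v) ⋄[ s ] (Z ⊗ w)
    ≈ Z ⊗ ((v ⋄[ s ] (Z ⊗ w)) ⊕ ((z₁ ⊗ v) ⋄[ s ] w) ⊖ Z ⊗ (v ⋄[ s ] w)))
    × ((z₁ ⊗ v) ⋄[ s ] (Zδ t ⊗ w)
    ≈ Z ⊗ (v ⋄[ s ] (Zδ t ⊗ w)) ⊕ Zδ t ⊗ ((z₁ ⊗ v) ⋄[ t ] w)
    ⊖ Z ⊗ Zδ t ⊗ (v ⋄[ t ] w))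
    × (τ (v ⋄[ s ] 𝟙) ≈ (τ₁ v) ⋄[ s ] 𝟙)
lemma5p9 m s t v v′ w =
  ≋⇒≈ (⋄𝟙-⊗ s v v′) , ≋⇒≈ (vy⋄w[z-zδ] s t v w) , ≋⇒≈ (yv⋄zw s v w) , ≋⇒≈ (yv⋄zδw s t v w) ,
  ≋⇒≈ (zv⋄zw s v w) , ≋⇒≈ (zv⋄zδw s t v w) , ≋⇒≈ (τ-⋄-𝟙 s v)
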